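{- Let $p_k$ be a prime and $p_{k+1}$ the next prime. Let $s$ be a constellation of length $j$ and sum $g<2p_{k+1}$. Then $$n_{s,j}(p_{k+1}\#)=(p_{k+1}-j-1)\,n_{s,j}(p_k\#)+n_{s,j+1}(p_k\#).$$
   Context: For a prime $p$, $p\#$ denotes the product of all primes $\le p$. For a positive integer $N$, let $1=u_0<u_1<\dots<u_{\varphi(N)}=N+1$ be the integers in $[1,N+1]$ coprime to $N$; the cycle of gaps is $\mathcal{G}(N)=(g_1,\dots,g_{\varphi(N)})$ with $g_i=u_i-u_{i-1}$, indices read cyclically mod $\varphi(N)$. A constellation is a finite sequence $s=(s_1,\dots,s_{j_1})$ of positive integers, of length $j_1$ and sum $s_1+\dots+s_{j_1}$. For $j\ge j_1$, a driving term of length $j$ for $s$ in $\mathcal{G}(N)$ is a position $i\in\{1,\dots,\varphi(N)\}$ such that the $j$ cyclically consecutive gaps $g_i,\dots,g_{i+j-1}$ can be split into $j_1$ consecutive nonempty blocks with sums $s_1,\dots,s_{j_1}$ in order; $n_{s,j}(N)$ denotes the number of such positions (for $j=j_1$ these are the occurrences of $s$). -}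

module Defs where

open import Data.Nat using (ℕ; zero; suc; _+_; _*_; _∸_; _<_; _≤_)
open import Data.Nat.DivMod using (_%_)
open import Data.Nat.Primality using (Prime; prime?)
open import Data.Nat.Coprimality using (Coprime; coprime?)
open import Data.Bool using (Bool; true; false; _∧_; _∨_)
import Data.Bool
open import Data.Product using (_×_)
open import Relation.Nullary using (¬_)
open import Data.List using (List; []; _∷_; map; filter; upTo; length;  take; drop)
open import Relation.Nullary.Decidable using (⌊_⌋)
open import Data.Nat using (_≡ᵇ_)
open import Data.Nat.ListAction using (sum; product)

primorial : ℕ → ℕ
primorial n = product (filter prime? (map suc (upTo n)))

coprimeList : ℕ → List ℕ
coprimeList N = filter (λ u → coprime? u N) (map suc (upTo (suc N)))

diffs : List ℕ → List ℕ
diffs []           = []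
diffs (x ∷ [])     = []
diffs (x ∷ y ∷ xs) = (y ∸ x) ∷ diffs (y ∷ xs)

-- the cycle of gaps 𝒢(N) = (g₁, …, g_φ(N)), stored as a list of length φ(N)
gaps : ℕ → List ℕ
gaps N = diffs (coprimeList N)

nth : List ℕ → ℕ → ℕ
nth []       _       = 0
nth (x ∷ xs) zero    = x
nth (x ∷ xs) (suc k) = nth xs k

cyc : List ℕ → ℕ → ℕ
cyc xs k with length xs
... | zero  = 0
... | suc m = nth xs (k % suc m)

window : List ℕ → ℕ → ℕ → List ℕ
window G i j = map (λ t → cyc G (i + t)) (upTo j)

-- blocks c gs ss : the current (nonempty) block has sum c so far and the remaining
-- gaps gs can complete it, so that the blocks have sums ss in order
blocks : ℕ → List ℕ → List ℕ → Bool
blocks c []       (s ∷ [])  = c ≡ᵇ s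
blocks c []       _         = false
blocks c (g ∷ gs) []        = false
blocks c (g ∷ gs) (s ∷ ss)  = ((c ≡ᵇ s) ∧ blocks g gs ss) ∨ blocks (c + g) gs (s ∷ ss)

canSplit : List ℕ → List ℕ → Bool
canSplit []       []      = true
canSplit []       (_ ∷ _) = false
canSplit (g ∷ gs) ss      = blocks g gs ss

-- n_{s,j}(N): number of positions i ∈ {1,…,φ(N)} (0-based here) that are driving terms
-- of length j for s in 𝒢(N)
nDrive : List ℕ → ℕ → ℕ → ℕ
nDrive s j N = length (filter (λ i → canSplit (window (gaps N) i j) s ≟ᵇ true) (upTo (length (gaps N))))
  where
  _≟ᵇ_ = Data.Bool._≟_

NextPrime : ℕ → ℕ → Set
NextPrime p q = Prime q × p < q × (∀ r → p < r → r < q → ¬ Prime r)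

module Submission where

-- Let N = p_k# and q = p_{k+1}, so that p_{k+1}# = qN. A position of 𝒢(N) is a point y ∈ [1, N] coprime to N,
-- and it is a driving term of length j for s iff the points y + s₁ + ⋯ + sᵢ are all coprime to N and the
-- window [y, y + g] contains exactly j + 1 points coprime to N. The points coprime to qN are those coprime
-- to N and prime to q, and y lifts to the q points y + mN, m < q. As q ∤ N, every point of the window is a
-- multiple of q in exactly one lift; as N is even, q is odd and g < 2q, no lift loses more than one point of
-- the window. So if y is a driving term of length j, the j + 1 lifts losing a point of the pattern die and
-- the other q − j − 1 survive; if y is one of length j + 1, exactly the lift losing its only point outside
-- the pattern becomes one of length j; other y contribute nothing.

open import Data.Nat using (ℕ)
open import Data.Nat.Divisibility using (_∣_)
open import Data.Nat.Primality using (Prime)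
open import Relation.Nullary using (¬_)

module BoolFacts where

  open import Data.Nat using (_≡ᵇ_)
  open import Data.Nat.Properties using (≡ᵇ⇒≡; ≡⇒≡ᵇ)
  open import Data.Bool using (true; false; _∧_; _∨_; T)
  open import Data.Bool.Properties using (∨-zeroʳ)
  open import Data.Sum using (_⊎_; inj₁; inj₂)
  open import Relation.Binary.PropositionalEquality
  open import Relation.Nullary using (Dec; yes; does; contradiction)

  true≢false : true ≢ false
  true≢false ()

  ∧-intro : ∀ {a b} → a ≡ true → b ≡ true → a ∧ b ≡ true
  ∧-intro refl b≡true = b≡true

  ∨-elim : ∀ {a b} → a ∨ b ≡ true → a ≡ true ⊎ b ≡ true
  ∨-elim {true}  _      = inj₁ refl
  ∨-elim {false} b≡true = inj₂ b≡true

  ∨-introˡ : ∀ {a b} → a ≡ true → a ∨ b ≡ true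
  ∨-introˡ refl = refl

  ∨-introʳ : ∀ a {b} → b ≡ true → a ∨ b ≡ true
  ∨-introʳ a refl = ∨-zeroʳ a

  ≡-true-iff⇒≡ : ∀ {a b} → (a ≡ true → b ≡ true) → (b ≡ true → a ≡ true) → a ≡ b
  ≡-true-iff⇒≡ {false} {false} _ _ = refl
  ≡-true-iff⇒≡ {false} {true}  _ f = f refl
  ≡-true-iff⇒≡ {true}          t _ = sym (t refl)

  does≡true⇒ : ∀ {A : Set} (a? : Dec A) → does a? ≡ true → A
  does≡true⇒ (yes a) _ = a

  ≡ᵇ-true⇒≡ : ∀ {m n} → (m ≡ᵇ n) ≡ true → m ≡ n
  ≡ᵇ-true⇒≡ {m} {n} eq = ≡ᵇ⇒≡ m n (subst T (sym eq) _)

  ≡⇒≡ᵇ-true : ∀ {m n} → m ≡ n → (m ≡ᵇ n) ≡ true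
  ≡⇒≡ᵇ-true {m} refl with m ≡ᵇ m | ≡⇒≡ᵇ m m refl
  ... | true | _ = refl

  ≢⇒≡ᵇ-false : ∀ {m n} → m ≢ n → (m ≡ᵇ n) ≡ false
  ≢⇒≡ᵇ-false {m} {n} m≢n with m ≡ᵇ n in eq
  ... | false = refl
  ... | true  = contradiction (≡ᵇ-true⇒≡ eq) m≢n

module FiniteSums where

  open import Data.Nat
  open import Data.Nat.Properties
  open import Algebra.Properties.CommutativeSemigroup +-commutativeSemigroup
    using () renaming (interchange to +-interchange)
  open import Data.Bool using (Bool; true; false)
  open import Data.Product using (∃-syntax; _×_; _,_)
  open import Data.Empty using (⊥; ⊥-elim)
  open import Function using (_∘_)
  open import Relation.Binary.PropositionalEquality
  open ≡-Reasoning

  𝟙 : Bool → ℕ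
  𝟙 true  = 1
  𝟙 false = 0

  ∑ : ℕ → (ℕ → ℕ) → ℕ
  ∑ zero    f = 0
  ∑ (suc n) f = f 0 + ∑ n (f ∘ suc)

  ∑-cong-< : ∀ n {f g : ℕ → ℕ} → (∀ i → i < n → f i ≡ g i) → ∑ n f ≡ ∑ n g
  ∑-cong-< zero    f≡g = refl
  ∑-cong-< (suc n) f≡g = cong₂ _+_ (f≡g 0 z<s) (∑-cong-< n (λ i i<n → f≡g (suc i) (s<s i<n)))

  ∑-cong : ∀ n {f g : ℕ → ℕ} → (∀ i → f i ≡ g i) → ∑ n f ≡ ∑ n g
  ∑-cong n f≡g = ∑-cong-< n (λ i _ → f≡g i)

  ∑-const : ∀ n c → ∑ n (λ _ → c) ≡ n * c
  ∑-const zero    c = refl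
  ∑-const (suc n) c = cong (c +_) (∑-const n c)

  ∑-zero : ∀ n {f : ℕ → ℕ} → (∀ i → i < n → f i ≡ 0) → ∑ n f ≡ 0
  ∑-zero n f≡0 = trans (∑-cong-< n f≡0) (trans (∑-const n 0) (*-zeroʳ n))

  ∑-distrib-+ : ∀ n (f g : ℕ → ℕ) → ∑ n (λ i → f i + g i) ≡ ∑ n f + ∑ n g
  ∑-distrib-+ zero    f g = refl
  ∑-distrib-+ (suc n) f g = begin
    (f 0 + g 0) + ∑ n (λ i → f (suc i) + g (suc i))
      ≡⟨ cong ((f 0 + g 0) +_) (∑-distrib-+ n (f ∘ suc) (g ∘ suc)) ⟩
    (f 0 + g 0) + (∑ n (f ∘ suc) + ∑ n (g ∘ suc))
      ≡⟨ +-interchange (f 0) (g 0) _ _ ⟩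
    (f 0 + ∑ n (f ∘ suc)) + (g 0 + ∑ n (g ∘ suc)) ∎

  ∑-distribˡ-* : ∀ n c (f : ℕ → ℕ) → ∑ n (λ i → c * f i) ≡ c * ∑ n f
  ∑-distribˡ-* zero    c f = sym (*-zeroʳ c)
  ∑-distribˡ-* (suc n) c f =
    trans (cong (c * f 0 +_) (∑-distribˡ-* n c (f ∘ suc))) (sym (*-distribˡ-+ c (f 0) _))

  ∑-+ : ∀ m n (f : ℕ → ℕ) → ∑ (m + n) f ≡ ∑ m f + ∑ n (λ i → f (m + i))
  ∑-+ zero    n f = refl
  ∑-+ (suc m) n f = trans (cong (f 0 +_) (∑-+ m n (f ∘ suc))) (sym (+-assoc (f 0) _ _))

  ∑-suc : ∀ n (f : ℕ → ℕ) → ∑ (suc n) f ≡ ∑ n f + f n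
  ∑-suc n f = begin
    ∑ (suc n) f              ≡⟨ cong (λ k → ∑ k f) (+-comm 1 n) ⟩
    ∑ (n + 1) f              ≡⟨ ∑-+ n 1 f ⟩
    ∑ n f + (f (n + 0) + 0)  ≡⟨ cong (∑ n f +_) (trans (+-identityʳ _) (cong f (+-identityʳ n))) ⟩
    ∑ n f + f n              ∎

  ∑-rotate : ∀ n (f : ℕ → ℕ) → f n ≡ f 0 → ∑ n (f ∘ suc) ≡ ∑ n f
  ∑-rotate n f fn≡f0 = +-cancelˡ-≡ (f 0) _ _ (begin
    f 0 + ∑ n (f ∘ suc) ≡⟨ ∑-suc n f ⟩
    ∑ n f + f n         ≡⟨ cong (∑ n f +_) fn≡f0 ⟩
    ∑ n f + f 0         ≡⟨ +-comm (∑ n f) (f 0) ⟩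
    f 0 + ∑ n f         ∎)

  ∑-comm : ∀ m n (f : ℕ → ℕ → ℕ) → ∑ m (λ i → ∑ n (f i)) ≡ ∑ n (λ k → ∑ m (λ i → f i k))
  ∑-comm zero    n f = sym (∑-zero n (λ _ _ → refl))
  ∑-comm (suc m) n f = begin
    ∑ n (f 0) + ∑ m (λ i → ∑ n (f (suc i)))            ≡⟨ cong (∑ n (f 0) +_) (∑-comm m n (f ∘ suc)) ⟩
    ∑ n (f 0) + ∑ n (λ k → ∑ m (λ i → f (suc i) k))    ≡⟨ sym (∑-distrib-+ n (f 0) _) ⟩
    ∑ n (λ k → f 0 k + ∑ m (λ i → f (suc i) k))        ∎

  ∑-* : ∀ m n (f : ℕ → ℕ) → ∑ (m * n) f ≡ ∑ m (λ k → ∑ n (λ r → f (k * n + r)))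
  ∑-* zero    n f = refl
  ∑-* (suc m) n f = begin
    ∑ (n + m * n) f                                      ≡⟨ ∑-+ n (m * n) f ⟩
    ∑ n f + ∑ (m * n) (λ i → f (n + i))                  ≡⟨ cong (∑ n f +_) (∑-* m n (λ i → f (n + i))) ⟩
    ∑ n f + ∑ m (λ k → ∑ n (λ r → f (n + (k * n + r))))
      ≡⟨ cong (∑ n f +_) (∑-cong m (λ k → ∑-cong n (λ r → cong f (sym (+-assoc n (k * n) r))))) ⟩
    ∑ n f + ∑ m (λ k → ∑ n (λ r → f (suc k * n + r)))    ∎

  ∑-mono-≤ : ∀ n {f g : ℕ → ℕ} → (∀ i → i < n → f i ≤ g i) → ∑ n f ≤ ∑ n g
  ∑-mono-≤ zero    f≤g = z≤n
  ∑-mono-≤ (suc n) f≤g = +-mono-≤ (f≤g 0 z<s) (∑-mono-≤ n (λ i i<n → f≤g (suc i) (s<s i<n)))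

  term≤∑ : ∀ n (f : ℕ → ℕ) {i} → i < n → f i ≤ ∑ n f
  term≤∑ (suc n) f {zero}  _         = m≤m+n (f 0) _
  term≤∑ (suc n) f {suc i} (s<s i<n) = ≤-trans (term≤∑ n (f ∘ suc) i<n) (m≤n+m _ (f 0))

  ∑>0⇒term>0 : ∀ n (f : ℕ → ℕ) → 0 < ∑ n f → ∃[ i ] (i < n × 0 < f i)
  ∑>0⇒term>0 (suc n) f ∑>0 with f 0 in f0≡
  ... | suc _ = 0 , z<s , subst (0 <_) (sym f0≡) z<s
  ... | zero  with ∑>0⇒term>0 n (f ∘ suc) ∑>0
  ...   | i , i<n , fi>0 = suc i , s<s i<n , fi>0

  ∑-𝟙≤1 : ∀ n (b : ℕ → Bool) → (∀ i k → i < k → k < n → b i ≡ true → b k ≡ true → ⊥) →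
          ∑ n (𝟙 ∘ b) ≤ 1
  ∑-𝟙≤1 zero    b unique = z≤n
  ∑-𝟙≤1 (suc n) b unique with b 0 in b0
  ... | false = ∑-𝟙≤1 n (b ∘ suc) (λ i k i<k k<n → unique (suc i) (suc k) (s<s i<k) (s<s k<n))
  ... | true  = ≤-reflexive (cong suc (∑-zero n others))
    where
    others : ∀ i → i < n → 𝟙 (b (suc i)) ≡ 0
    others i i<n with b (suc i) in bi
    ... | false = refl
    ... | true  = ⊥-elim (unique 0 (suc i) z<s (s<s i<n) b0 bi)

  ∑≤1≡n⇒≡1 : ∀ n (f : ℕ → ℕ) → (∀ i → i < n → f i ≤ 1) → ∑ n f ≡ n → ∀ i → i < n → f i ≡ 1
  ∑≤1≡n⇒≡1 (suc n) f f≤1 ∑≡n = at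
    where
    rest≤n : ∑ n (f ∘ suc) ≤ n
    rest≤n = ≤-trans (∑-mono-≤ n (λ i i<n → f≤1 (suc i) (s<s i<n)))
                     (≤-reflexive (trans (∑-const n 1) (*-identityʳ n)))
    f0≡1 : f 0 ≡ 1
    f0≡1 = ≤-antisym (f≤1 0 z<s)
      (+-cancelʳ-≤ n 1 (f 0) (≤-trans (≤-reflexive (sym ∑≡n)) (+-monoʳ-≤ (f 0) rest≤n)))
    rest≡n : ∑ n (f ∘ suc) ≡ n
    rest≡n = suc-injective (trans (cong (_+ ∑ n (f ∘ suc)) (sym f0≡1)) ∑≡n)
    at : ∀ i → i < suc n → f i ≡ 1
    at zero    _         = f0≡1
    at (suc i) (s<s i<n) = ∑≤1≡n⇒≡1 n (f ∘ suc) (λ k k<n → f≤1 (suc k) (s<s k<n)) rest≡n i i<n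

module Primorials where

  open import Defs using (primorial; NextPrime)
  open import Data.Nat
  open import Data.Nat.Properties
  open import Data.Nat.Divisibility
  open import Data.Nat.Primality
  open import Data.Nat.ListAction using (product)
  open import Data.Nat.ListAction.Properties using (product-++; ∈⇒∣product)
  open import Data.List using (List; []; _∷_; map; filter; upTo; _++_; [_])
  open import Data.List.Properties using (filter-++; filter-accept; filter-reject; map-++; upTo-∷ʳ)
  open import Data.List.Relation.Unary.All as All using (All; []; _∷_)
  open import Data.List.Membership.Propositional using (_∈_)
  open import Data.List.Membership.Propositional.Properties
    using (∈-filter⁺; ∈-filter⁻; ∈-map⁺; ∈-map⁻; ∈-upTo⁺; ∈-upTo⁻)
  open import Data.Product using (_×_; _,_; proj₁)
  open import Data.Sum using (inj₁; inj₂)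
  open import Function using (_∘_)
  open import Relation.Binary.PropositionalEquality hiding ([_])
  open import Relation.Nullary using (¬_)
  open ≡-Reasoning

  primesUpTo : ℕ → List ℕ
  primesUpTo n = filter prime? (map suc (upTo n))

  ∈-primesUpTo⁻ : ∀ {n x} → x ∈ primesUpTo n → Prime x × x ≤ n
  ∈-primesUpTo⁻ {n} x∈ with x∈map , px ← ∈-filter⁻ prime? {xs = map suc (upTo n)} x∈
    with _ , y∈ , refl ← ∈-map⁻ suc {xs = upTo n} x∈map = px , ∈-upTo⁻ y∈

  primorial-suc : ∀ n → primorial (suc n) ≡ primorial n * product (filter prime? [ suc n ])
  primorial-suc n = begin
    product (filter prime? (map suc (upTo (suc n))))
      ≡⟨ cong (λ l → product (filter prime? (map suc l))) (sym (upTo-∷ʳ n)) ⟩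
    product (filter prime? (map suc (upTo n ++ [ n ])))
      ≡⟨ cong (product ∘ filter prime?) (map-++ suc (upTo n) [ n ]) ⟩
    product (filter prime? (map suc (upTo n) ++ [ suc n ]))
      ≡⟨ cong product (filter-++ prime? (map suc (upTo n)) [ suc n ]) ⟩
    product (primesUpTo n ++ filter prime? [ suc n ])
      ≡⟨ product-++ (primesUpTo n) _ ⟩
    primorial n * product (filter prime? [ suc n ]) ∎

  primorial-suc-nonprime : ∀ n → ¬ Prime (suc n) → primorial (suc n) ≡ primorial n
  primorial-suc-nonprime n ¬p = begin
    primorial (suc n)                               ≡⟨ primorial-suc n ⟩
    primorial n * product (filter prime? [ suc n ]) ≡⟨ cong (λ l → primorial n * product l) (filter-reject prime? ¬p) ⟩
    primorial n * 1                                 ≡⟨ *-identityʳ _ ⟩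
    primorial n                                     ∎

  primorial-suc-prime : ∀ n → Prime (suc n) → primorial (suc n) ≡ suc n * primorial n
  primorial-suc-prime n p = begin
    primorial (suc n)                               ≡⟨ primorial-suc n ⟩
    primorial n * product (filter prime? [ suc n ]) ≡⟨ cong (λ l → primorial n * product l) (filter-accept prime? p) ⟩
    primorial n * (suc n * 1)                       ≡⟨ cong (primorial n *_) (*-identityʳ _) ⟩
    primorial n * suc n                             ≡⟨ *-comm _ (suc n) ⟩
    suc n * primorial n                             ∎

  primorial-gap : ∀ {p q} → (∀ r → p < r → r < q → ¬ Prime r) →
                  ∀ {n} → p ≤ n → n < q → primorial n ≡ primorial p
  primorial-gap noPrime {n} p≤n n<q with m≤n⇒m<n∨m≡n p≤n
  ... | inj₂ refl = refl
  primorial-gap noPrime {suc n} p≤n n<q | inj₁ p<1+n =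
    trans (primorial-suc-nonprime n (noPrime (suc n) p<1+n n<q))
          (primorial-gap noPrime (≤-pred p<1+n) (<-trans (n<1+n n) n<q))

  primorial-nextPrime : ∀ {p q} → NextPrime p q → primorial q ≡ q * primorial p
  primorial-nextPrime {p} {suc q} (q-prime , p<q , noPrime) =
    trans (primorial-suc-prime q q-prime)
          (cong (suc q *_) (primorial-gap noPrime (≤-pred p<q) (n<1+n q)))

  prime∤product : ∀ {q} → Prime q → ∀ {xs} → All (λ x → Prime x × x < q) xs → ¬ q ∣ product xs
  prime∤product q-prime []                    q∣1 = ¬prime[1] (subst Prime (∣1⇒≡1 q∣1) q-prime)
  prime∤product q-prime {x ∷ xs} ((x-prime , x<q) ∷ small) q∣x*xs
    with euclidsLemma x (product xs) q-prime q∣x*xs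
  ... | inj₁ q∣x = <⇒≱ x<q (∣⇒≤ {{prime⇒nonZero x-prime}} q∣x)
  ... | inj₂ q∣xs = prime∤product q-prime small q∣xs

  prime∤primorial : ∀ {p q} → Prime q → p < q → ¬ q ∣ primorial p
  prime∤primorial {p} q-prime p<q =
    prime∤product q-prime (All.tabulate (λ x∈ → let (x-prime , x≤p) = ∈-primesUpTo⁻ x∈
                                                in x-prime , ≤-<-trans x≤p p<q))

  2∣primorial : ∀ {p} → 2 ≤ p → 2 ∣ primorial p
  2∣primorial 2≤p = ∈⇒∣product (∈-filter⁺ prime? (∈-map⁺ suc (∈-upTo⁺ 2≤p)) prime[2])

  primorial≥1 : ∀ p → primorial p ≥ 1
  primorial≥1 p = productOfPrimes≥1 (All.tabulate (λ x∈ → proj₁ (∈-primesUpTo⁻ {p} x∈)))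

module Coprimality where

  open import Data.Nat
  open import Data.Nat.Properties
  open import Data.Nat.Divisibility
  open import Data.Nat.Primality
  open import Data.Nat.Coprimality using (Coprime; coprime?; coprime-+; coprime-divisor)
  open import Algebra.Properties.CommutativeSemigroup +-commutativeSemigroup
    using () renaming (x∙yz≈xz∙y to m+[n+o]≡m+o+n)
  open import Data.Bool using (Bool; _∧_; not; true)
  open import Data.Product using (_×_; _,_)
  open import Data.Sum using (_⊎_; inj₁; inj₂)
  open import Function.Bundles using (mk⇔)
  open import Relation.Binary.PropositionalEquality
  open import Relation.Nullary using (¬_; does; ¬?; _×-dec_; contradiction)
  open import Relation.Nullary.Decidable using (does-⇔)
  open ≡-Reasoning
  open BoolFacts using (does≡true⇒)

  coprimeTo : ℕ → ℕ → Bool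
  coprimeTo N y = does (coprime? y N)

  divisibleBy : ℕ → ℕ → Bool
  divisibleBy q y = does (q ∣? y)

  coprimeTo-+ : ∀ N y → coprimeTo N (y + N) ≡ coprimeTo N y
  coprimeTo-+ N y = does-⇔ (mk⇔ to from) (coprime? (y + N) N) (coprime? y N)
    where
    to : Coprime (y + N) N → Coprime y N
    to c (d∣y , d∣N) = c (∣m∣n⇒∣m+n d∣y d∣N , d∣N)
    from : Coprime y N → Coprime (y + N) N
    from c = subst (λ t → Coprime t N) (+-comm N y) (coprime-+ c)

  coprimeTo-+* : ∀ N y m → coprimeTo N (y + m * N) ≡ coprimeTo N y
  coprimeTo-+* N y zero    = cong (coprimeTo N) (+-identityʳ y)
  coprimeTo-+* N y (suc m) = begin
    coprimeTo N (y + (N + m * N)) ≡⟨ cong (coprimeTo N) (m+[n+o]≡m+o+n y N (m * N)) ⟩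
    coprimeTo N (y + m * N + N)   ≡⟨ coprimeTo-+ N (y + m * N) ⟩
    coprimeTo N (y + m * N)       ≡⟨ coprimeTo-+* N y m ⟩
    coprimeTo N y                 ∎

  coprimeTo-*prime : ∀ {q} N y → Prime q →
                     coprimeTo (q * N) y ≡ coprimeTo N y ∧ not (divisibleBy q y)
  coprimeTo-*prime {q} N y q-prime =
    does-⇔ (mk⇔ to from) (coprime? y (q * N)) (coprime? y N ×-dec ¬? (q ∣? y))
    where
    to : Coprime y (q * N) → Coprime y N × ¬ q ∣ y
    to c = (λ (d∣y , d∣N) → c (d∣y , ∣n⇒∣m*n q d∣N))
         , (λ q∣y → ¬prime[1] (subst Prime (c (q∣y , m∣m*n N)) q-prime))
    from : Coprime y N × ¬ q ∣ y → Coprime y (q * N)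
    from (c , q∤y) {d} (d∣y , d∣qN)
      with prime⇒irreducible q-prime
             (coprime-divisor (λ (e∣d , e∣N) → c (∣-trans e∣d d∣y , e∣N)) (subst (d ∣_) (*-comm q N) d∣qN))
    ... | inj₁ d≡1 = d≡1
    ... | inj₂ refl = contradiction d∣y q∤y

  coprimeTo-even⇒odd : ∀ {N y} → 2 ∣ N → coprimeTo N y ≡ true → ¬ 2 ∣ y
  coprimeTo-even⇒odd {N} {y} 2∣N cop 2∣y with () ← does≡true⇒ (coprime? y N) cop (2∣y , 2∣N)

  divisibleBy-+ : ∀ q a → divisibleBy q (a + q) ≡ divisibleBy q a
  divisibleBy-+ q a = does-⇔ (mk⇔ to from) (q ∣? (a + q)) (q ∣? a)
    where
    to : q ∣ a + q → q ∣ a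
    to q∣a+q = ∣m+n∣m⇒∣n (subst (q ∣_) (+-comm a q) q∣a+q) ∣-refl
    from : q ∣ a → q ∣ a + q
    from q∣a = ∣m∣n⇒∣m+n q∣a ∣-refl

  even-or-odd : ∀ n → 2 ∣ n ⊎ 2 ∣ suc n
  even-or-odd zero    = inj₁ (2 ∣0)
  even-or-odd (suc n) with even-or-odd n
  ... | inj₁ 2∣n   = inj₂ (∣m∣n⇒∣m+n {n = n} ∣-refl 2∣n)
  ... | inj₂ 2∣1+n = inj₁ 2∣1+n

  odd+t-odd⇒even : ∀ a t → ¬ 2 ∣ a → ¬ 2 ∣ a + t → 2 ∣ t
  odd+t-odd⇒even a t odd-a odd-a+t with even-or-odd a | even-or-odd (a + t)
  ... | inj₁ 2∣a   | _            = contradiction 2∣a odd-a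
  ... | _          | inj₁ 2∣a+t   = contradiction 2∣a+t odd-a+t
  ... | inj₂ 2∣1+a | inj₂ 2∣1+a+t = ∣m+n∣m⇒∣n 2∣1+a+t 2∣1+a

module Splitting where

  open import Defs using (blocks; canSplit)
  open FiniteSums
  open BoolFacts
  open import Data.Nat
  open import Data.Nat.Properties
  open import Data.Nat.ListAction using (sum)
  open import Data.Bool using (Bool; true; false; _∧_)
  open import Data.Bool.Properties using (∧-conicalˡ; ∧-conicalʳ)
  open import Data.List using (List; []; _∷_; length)
  open import Data.List.Relation.Unary.All using (All; []; _∷_)
  open import Data.Product using (∃-syntax; _×_; _,_)
  open import Data.Sum using (inj₁; inj₂)
  open import Function using (_∘_)
  open import Relation.Binary.Definitions using (tri<; tri≈; tri>)
  open import Relation.Binary.PropositionalEquality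
  open import Relation.Nullary using (yes; no; contradiction)
  open ≡-Reasoning

  module _ (P : ℕ → Bool) where

    hits : ℕ → List ℕ → Bool
    hits x []       = P x
    hits x (s ∷ ss) = P x ∧ hits (x + s) ss

    count : ℕ → ℕ → ℕ
    count x g = ∑ (suc g) (λ d → 𝟙 (P (x + d)))

    drives : List ℕ → ℕ → ℕ → Bool
    drives s j x = hits x s ∧ (count x (sum s) ≡ᵇ suc j)

    NextAfter : ℕ → ℕ → Set
    NextAfter x w = 0 < w × (∀ d → 0 < d → d < w → P (x + d) ≡ false)

    Consecutive : ℕ → List ℕ → Set
    Consecutive x []       = P x ≡ true
    Consecutive x (w ∷ ws) = P x ≡ true × NextAfter x w × Consecutive (x + w) ws

    consecutive-head : ∀ {x} w → Consecutive x w → P x ≡ true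
    consecutive-head []      Px           = Px
    consecutive-head (_ ∷ _) (Px , _ , _) = Px

    hits-head : ∀ {x} ss → hits x ss ≡ true → P x ≡ true
    hits-head []      h = h
    hits-head (_ ∷ _) h = ∧-conicalˡ _ _ h

    hits-last : ∀ {x} ss → hits x ss ≡ true → P (x + sum ss) ≡ true
    hits-last {x} []       h = subst (λ t → P t ≡ true) (sym (+-identityʳ x)) h
    hits-last {x} (s ∷ ss) h =
      subst (λ t → P t ≡ true) (+-assoc x s (sum ss)) (hits-last ss (∧-conicalʳ _ _ h))

    P-resp : ∀ {a b} → a ≡ b → P a ≡ true → P b ≡ true
    P-resp = subst (λ t → P t ≡ true)

    hits-resp : ∀ {a b} ss → a ≡ b → hits a ss ≡ true → hits b ss ≡ true
    hits-resp ss = subst (λ t → hits t ss ≡ true)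

    -- The open block has sum c so far and the walk is at y with gaps gs still to come; the block is closed
    -- after e more, and the remaining block sums ss must then start at y + e.
    Completion : ℕ → ℕ → List ℕ → ℕ → List ℕ → Set
    Completion c y gs s ss = ∃[ e ] (c + e ≡ s × hits (y + e) ss ≡ true × e + sum ss ≡ sum gs)

    blocks⇒completion : ∀ {c y} gs {s} ss → Consecutive y gs →
                        blocks c gs (s ∷ ss) ≡ true → Completion c y gs s ss
    blocks⇒completion {c} {y} [] [] Py c≡s =
      0 , trans (+-identityʳ c) (≡ᵇ-true⇒≡ c≡s) , P-resp (sym (+-identityʳ y)) Py , refl
    blocks⇒completion [] (_ ∷ _) _ ()
    blocks⇒completion {c} {y} (g ∷ gs) {s} ss (Py , _ , W) h with ∨-elim h
    ... | inj₂ extend with e , c+g+e≡s , hit , sums ← blocks⇒completion gs ss W extend =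
      g + e , trans (sym (+-assoc c g e)) c+g+e≡s , hits-resp ss (+-assoc y g e) hit ,
      trans (+-assoc g e (sum ss)) (cong (g +_) sums)
    ... | inj₁ close = closeBlock ss (∧-conicalʳ _ _ close)
      where
      closeBlock : ∀ ss → blocks g gs ss ≡ true → Completion c y (g ∷ gs) s ss
      closeBlock [] b = contradiction b (blocks-[] gs)
        where
        blocks-[] : ∀ gs → blocks g gs [] ≢ true
        blocks-[] []      ()
        blocks-[] (_ ∷ _) ()
      closeBlock (s₂ ∷ ss) b with e , g+e≡s₂ , hit , sums ← blocks⇒completion gs ss W b =
        0 , trans (+-identityʳ c) (≡ᵇ-true⇒≡ (∧-conicalˡ _ _ close)) ,
        ∧-intro (P-resp (sym (+-identityʳ y)) Py)
                (hits-resp ss (trans (+-assoc y g e) (trans (cong (y +_) g+e≡s₂) (cong (_+ s₂) (sym (+-identityʳ y))))) hit) ,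
        (begin
          s₂ + sum ss      ≡⟨ cong (_+ sum ss) (sym g+e≡s₂) ⟩
          g + e + sum ss   ≡⟨ +-assoc g e (sum ss) ⟩
          g + (e + sum ss) ≡⟨ cong (g +_) sums ⟩
          g + sum gs       ∎)

    completion⇒blocks : ∀ {c y} gs {s} ss → Consecutive y gs → All (0 <_) ss →
                        Completion c y gs s ss → blocks c gs (s ∷ ss) ≡ true
    completion⇒blocks {c} [] [] _ _ (zero , c+0≡s , _ , _) = ≡⇒≡ᵇ-true (trans (sym (+-identityʳ c)) c+0≡s)
    completion⇒blocks [] (s₂ ∷ ss) _ (s₂>0 ∷ _) (e , _ , _ , sums) =
      contradiction (m+n≡0⇒m≡0 s₂ (m+n≡0⇒n≡0 e sums)) (n>0⇒n≢0 s₂>0)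
    completion⇒blocks {c} {y} (g ∷ gs) {s} ss (Py , (g>0 , noneBefore) , W) pos (e , c+e≡s , hit , sums)
      with g ≤? e
    ... | yes g≤e with e′ , refl ← m≤n⇒∃[o]m+o≡n g≤e =
      ∨-introʳ _ (completion⇒blocks gs ss W pos
        (e′ , trans (+-assoc c g e′) c+e≡s , hits-resp ss (sym (+-assoc y g e′)) hit ,
         +-cancelˡ-≡ g _ _ (trans (sym (+-assoc g e′ (sum ss))) sums)))
    ... | no g≰e = closeBlock e (≰⇒> g≰e) c+e≡s hit sums
      where
      startBlock : ∀ ss → All (0 <_) ss → hits (y + 0) ss ≡ true → sum ss ≡ g + sum gs → blocks g gs ss ≡ true
      startBlock [] _ _ 0≡g+gs = contradiction (m+n≡0⇒m≡0 g (sym 0≡g+gs)) (n>0⇒n≢0 g>0)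
      startBlock (s₂ ∷ ss) (s₂>0 ∷ pos) hit sums with g ≤? s₂
      ... | no g≰s₂ = contradiction
            (trans (sym (P-resp (cong (_+ s₂) (+-identityʳ y)) (hits-head ss (∧-conicalʳ _ _ hit))))
                   (noneBefore s₂ s₂>0 (≰⇒> g≰s₂)))
            true≢false
      ... | yes g≤s₂ with e , refl ← m≤n⇒∃[o]m+o≡n g≤s₂ =
        completion⇒blocks gs ss W pos
          (e , refl ,
           hits-resp ss (trans (cong (_+ (g + e)) (+-identityʳ y)) (sym (+-assoc y g e))) (∧-conicalʳ _ _ hit) ,
           +-cancelˡ-≡ g _ _ (trans (sym (+-assoc g e (sum ss))) sums))
      closeBlock : ∀ e → e < g → c + e ≡ s → hits (y + e) ss ≡ true → e + sum ss ≡ g + sum gs →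
                   blocks c (g ∷ gs) (s ∷ ss) ≡ true
      closeBlock (suc e) e<g _ hit _ =
        contradiction (trans (sym (hits-head ss hit)) (noneBefore (suc e) z<s e<g)) true≢false
      closeBlock zero _ c+0≡s hit sums =
        ∨-introˡ (∧-intro (≡⇒≡ᵇ-true (trans (sym (+-identityʳ c)) c+0≡s)) (startBlock ss pos hit sums))

    canSplit⇒ : ∀ {x} w s → Consecutive x w → All (0 <_) s →
                canSplit w s ≡ true → hits x s ≡ true × sum s ≡ sum w
    canSplit⇒ []       []      Px _ _  = Px , refl
    canSplit⇒ []       (_ ∷ _) _  _ ()
    canSplit⇒ (g ∷ [])    [] _ _ ()
    canSplit⇒ (g ∷ _ ∷ _) [] _ _ ()
    canSplit⇒ {x} (g ∷ gs) (suc s ∷ ss) W (_ ∷ _) h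
      with e , 0+e≡s , hit , sums ← blocks⇒completion {0} (g ∷ gs) ss W h =
      ∧-intro (consecutive-head (g ∷ gs) W) (hits-resp ss (cong (x +_) 0+e≡s) hit) ,
      trans (cong (_+ sum ss) (sym 0+e≡s)) sums

    canSplit⇐ : ∀ {x} w s → Consecutive x w → All (0 <_) s →
                hits x s ≡ true → sum s ≡ sum w → canSplit w s ≡ true
    canSplit⇐ []       []           _ _          _   _    = refl
    canSplit⇐ []       (s ∷ ss)     _ (s>0 ∷ _)  _   sums =
      contradiction (m+n≡0⇒m≡0 s sums) (n>0⇒n≢0 s>0)
    canSplit⇐ (g ∷ gs) []           (_ , (g>0 , _) , _) _ _ sums =
      contradiction (m+n≡0⇒m≡0 g (sym sums)) (n>0⇒n≢0 g>0)
    canSplit⇐ (g ∷ gs) (suc s ∷ ss) W (_ ∷ pos) hit sums =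
      completion⇒blocks {0} (g ∷ gs) ss W pos (suc s , refl , ∧-conicalʳ _ _ hit , sums)

    count-+ : ∀ x a b → count x (suc a + b) ≡ count x a + count (x + suc a) b
    count-+ x a b = begin
      ∑ (suc (suc a + b)) f                      ≡⟨ cong (λ n → ∑ (suc n) f) (sym (+-suc a b)) ⟩
      ∑ (suc a + suc b) f                        ≡⟨ ∑-+ (suc a) (suc b) f ⟩
      count x a + ∑ (suc b) (λ i → f (suc a + i))
        ≡⟨ cong (count x a +_) (∑-cong (suc b) (λ i → cong (𝟙 ∘ P) (sym (+-assoc x (suc a) i)))) ⟩
      count x a + count (x + suc a) b            ∎
      where
      f : ℕ → ℕ
      f d = 𝟙 (P (x + d))

    count-gap : ∀ {x w} → P x ≡ true → NextAfter x w → ∀ {a} → a < w → count x a ≡ 1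
    count-gap {x} Px (_ , noneBefore) {a} a<w = cong₂ _+_
      (cong 𝟙 (trans (cong P (+-identityʳ x)) Px))
      (∑-zero a (λ i i<a → cong 𝟙 (noneBefore (suc i) z<s (≤-<-trans i<a a<w))))

    count-last : ∀ x b → P (x + b) ≡ true → 1 ≤ count x b
    count-last x b Px+b = subst (λ t → 𝟙 t ≤ count x b) Px+b (term≤∑ (suc b) (λ d → 𝟙 (P (x + d))) (n<1+n b))

    count-consecutive : ∀ {x} w → Consecutive x w → count x (sum w) ≡ suc (length w)
    count-consecutive {x} [] Px = cong (λ b → 𝟙 b + 0) (trans (cong P (+-identityʳ x)) Px)
    count-consecutive {x} (suc a ∷ ws) (Px , gap , W) =
      trans (count-+ x a (sum ws)) (cong₂ _+_ (count-gap Px gap ≤-refl) (count-consecutive ws W))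

    count-< : ∀ {x} w → Consecutive x w → ∀ {g} → g < sum w → count x g ≤ length w
    count-< {x} (suc a ∷ ws) (Px , gap , W) {g} g<w with g ≤? a
    ... | yes g≤a = ≤-trans (≤-reflexive (count-gap Px gap (s≤s g≤a))) (s≤s z≤n)
    ... | no g≰a with g′ , refl ← m≤n⇒∃[o]m+o≡n (≰⇒> g≰a) =
      subst (_≤ suc (length ws)) (sym (count-+ x a g′))
        (subst (λ n → n + count (x + suc a) g′ ≤ suc (length ws)) (sym (count-gap Px gap ≤-refl))
          (s≤s (count-< ws W (+-cancelˡ-< (suc a) g′ (sum ws) g<w))))

    count-> : ∀ {x} w → Consecutive x w → ∀ {g} → sum w < g → P (x + g) ≡ true → 2 + length w ≤ count x g
    count-> {x} [] Px {suc g} _ Px+g =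
      subst (2 ≤_) (sym (count-+ x 0 g))
        (+-mono-≤ (≤-reflexive (sym (count-consecutive [] Px)))
                  (count-last (x + 1) g (P-resp (sym (+-assoc x 1 g)) Px+g)))
    count-> {x} (suc a ∷ ws) (Px , gap , W) {g} w<g Px+g
      with g′ , refl ← m≤n⇒∃[o]m+o≡n (≤-trans (m≤m+n (suc a) (sum ws)) (<⇒≤ w<g)) =
      subst (3 + length ws ≤_) (sym (count-+ x a g′))
        (subst (λ n → 3 + length ws ≤ n + count (x + suc a) g′) (sym (count-gap Px gap ≤-refl))
          (s≤s (count-> ws W (+-cancelˡ-< (suc a) (sum ws) g′ w<g) (P-resp (sym (+-assoc x (suc a) g′)) Px+g))))

    count≡⇒sum≡ : ∀ {x} w → Consecutive x w → ∀ {g} → P (x + g) ≡ true →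
                  count x g ≡ suc (length w) → g ≡ sum w
    count≡⇒sum≡ w W {g} Px+g count≡ with <-cmp g (sum w)
    ... | tri≈ _ g≡w _ = g≡w
    ... | tri< g<w _ _ = contradiction (≤-trans (≤-reflexive (sym count≡)) (count-< w W g<w)) (n≮n (length w))
    ... | tri> _ _ w<g = contradiction (≤-trans (count-> w W w<g Px+g) (≤-reflexive count≡)) (n≮n (suc (length w)))

    canSplit≡drives : ∀ {x} w s → Consecutive x w → All (0 <_) s → canSplit w s ≡ drives s (length w) x
    canSplit≡drives {x} w s W pos = ≡-true-iff⇒≡ to from
      where
      to : canSplit w s ≡ true → drives s (length w) x ≡ true
      to split with hit , sums ← canSplit⇒ w s W pos split =
        ∧-intro hit (≡⇒≡ᵇ-true (trans (cong (count x) sums) (count-consecutive w W)))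
      from : drives s (length w) x ≡ true → canSplit w s ≡ true
      from d = canSplit⇐ w s W pos hit (count≡⇒sum≡ w W (hits-last s hit) (≡ᵇ-true⇒≡ (∧-conicalʳ _ _ d)))
        where
        hit : hits x s ≡ true
        hit = ∧-conicalˡ _ _ d

module Enumerations where

  open import Defs using (nth; diffs; cyc)
  open FiniteSums
  open import Data.Nat
  open import Data.Nat.Properties
  open import Data.Nat.DivMod
  open import Data.Bool using (Bool; true; false)
  open import Data.List using (List; []; _∷_; _++_; [_]; length; map; filter; upTo; applyUpTo)
  open import Data.List.Properties using (map-upTo)
  open import Data.Product using (_×_; _,_)
  open import Data.Sum using (_⊎_; inj₁; inj₂)
  open import Function using (_∘_)
  open import Relation.Binary.PropositionalEquality hiding ([_])
  open import Relation.Nullary using (yes; no; does; contradiction)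
  open import Relation.Unary using (Pred; Decidable)
  open import Level using (0ℓ)

  range : ℕ → ℕ → List ℕ
  range a zero    = []
  range a (suc n) = a ∷ range (suc a) n

  range-suc : ∀ a n → range a (suc n) ≡ range a n ++ [ a + n ]
  range-suc a zero    = cong [_] (sym (+-identityʳ a))
  range-suc a (suc n) = cong (a ∷_) (trans (range-suc (suc a) n) (cong (λ t → range (suc a) n ++ [ t ]) (sym (+-suc a n))))

  map-suc-upTo : ∀ n → map suc (upTo n) ≡ range 1 n
  map-suc-upTo n = trans (map-upTo suc n) (applyUpTo-+ 1 n)
    where
    applyUpTo-+ : ∀ a n → applyUpTo (a +_) n ≡ range a n
    applyUpTo-+ a zero    = refl
    applyUpTo-+ a (suc n) =
      cong₂ _∷_ (+-identityʳ a) (trans (applyUpTo-cong n (+-suc a)) (applyUpTo-+ (suc a) n))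
      where
      applyUpTo-cong : ∀ n {f g : ℕ → ℕ} → (∀ i → f i ≡ g i) → applyUpTo f n ≡ applyUpTo g n
      applyUpTo-cong zero    f≡g = refl
      applyUpTo-cong (suc n) f≡g = cong₂ _∷_ (f≡g 0) (applyUpTo-cong n (f≡g ∘ suc))

  nth-++ˡ : ∀ l r {i} → i < length l → nth (l ++ r) i ≡ nth l i
  nth-++ˡ (x ∷ l) r {zero}  _         = refl
  nth-++ˡ (x ∷ l) r {suc i} (s<s i<l) = nth-++ˡ l r i<l

  nth-++-length : ∀ l z → nth (l ++ [ z ]) (length l) ≡ z
  nth-++-length []      z = refl
  nth-++-length (x ∷ l) z = nth-++-length l z

  length-diffs : ∀ l → length (diffs l) ≡ pred (length l)
  length-diffs []           = refl
  length-diffs (x ∷ [])     = refl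
  length-diffs (x ∷ y ∷ l)  = cong suc (length-diffs (y ∷ l))

  nth-diffs : ∀ l {k} → suc k < length l → nth (diffs l) k ≡ nth l (suc k) ∸ nth l k
  nth-diffs (x ∷ [])    {zero}  (s<s ())
  nth-diffs (x ∷ y ∷ l) {zero}  _         = refl
  nth-diffs (x ∷ y ∷ l) {suc k} (s<s k<l) = nth-diffs (y ∷ l) k<l

  module _ {Q : Pred ℕ 0ℓ} (Q? : Decidable Q) where

    length-filter-upTo : ∀ n → length (filter Q? (upTo n)) ≡ ∑ n (λ i → 𝟙 (does (Q? i)))
    length-filter-upTo = go (λ i → i)
      where
      go : ∀ (f : ℕ → ℕ) n → length (filter Q? (applyUpTo f n)) ≡ ∑ n (λ i → 𝟙 (does (Q? (f i))))
      go f zero = refl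
      go f (suc n) with does (Q? (f 0))
      ... | true  = cong suc (go (f ∘ suc) n)
      ... | false = go (f ∘ suc) n

    ∑-nth-filter-range : ∀ (h : ℕ → ℕ) a n →
      ∑ (length (filter Q? (range a n))) (h ∘ nth (filter Q? (range a n)))
        ≡ ∑ n (λ x → 𝟙 (does (Q? (a + x))) * h (a + x))
    ∑-nth-filter-range h a zero = refl
    ∑-nth-filter-range h a (suc n) = trans first-term (cong₂ _+_
      (cong (λ t → 𝟙 (does (Q? t)) * h t) (sym (+-identityʳ a)))
      (∑-cong n (λ i → cong (λ t → 𝟙 (does (Q? t)) * h t) (sym (+-suc a i)))))
      where
      first-term : ∑ (length (filter Q? (range a (suc n)))) (h ∘ nth (filter Q? (range a (suc n))))
                   ≡ 𝟙 (does (Q? a)) * h a + ∑ n (λ x → 𝟙 (does (Q? (suc a + x))) * h (suc a + x))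
      first-term with does (Q? a)
      ... | true  = cong₂ _+_ (sym (+-identityʳ (h a))) (∑-nth-filter-range h (suc a) n)
      ... | false = ∑-nth-filter-range h (suc a) n

  module _ (P : ℕ → Bool) where

    Enumerates : ℕ → List ℕ → ℕ → Set
    Enumerates a []      b = ∀ y → a ≤ y → y < b → P y ≡ false
    Enumerates a (x ∷ l) b = a ≤ x × (∀ y → a ≤ y → y < x → P y ≡ false) × P x ≡ true × Enumerates (suc x) l b

    enumerates-nth : ∀ {a b} l {k} → Enumerates a l b → k < length l → P (nth l k) ≡ true
    enumerates-nth (x ∷ l) {zero}  (_ , _ , Px , _) _         = Px
    enumerates-nth (x ∷ l) {suc k} (_ , _ , _ , E)  (s<s k<l) = enumerates-nth l E k<l

    enumerates-next : ∀ {a b} l {k} → Enumerates a l b → suc k < length l →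
                      nth l k < nth l (suc k) × (∀ y → nth l k < y → y < nth l (suc k) → P y ≡ false)
    enumerates-next (x ∷ [])     {zero}  _                                  (s<s ())
    enumerates-next (x ∷ x′ ∷ l) {zero}  (_ , _ , _ , (x<x′ , between , _)) _ = x<x′ , between
    enumerates-next (x ∷ x′ ∷ l) {suc k} (_ , _ , _ , E)                    (s<s k<l) = enumerates-next (x′ ∷ l) E k<l

    enumerates-extend : ∀ {a b} l → Enumerates (suc a) l b → P a ≡ false → Enumerates a l b
    enumerates-extend {a} [] E Pa y a≤y y<b with m≤n⇒m<n∨m≡n a≤y
    ... | inj₁ a<y  = E y a<y y<b
    ... | inj₂ refl = Pa
    enumerates-extend {a} (x ∷ l) (a<x , before , Px , E) Pa = <⇒≤ a<x , before′ , Px , E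
      where
      before′ : ∀ y → a ≤ y → y < x → P y ≡ false
      before′ y a≤y y<x with m≤n⇒m<n∨m≡n a≤y
      ... | inj₁ a<y  = before y a<y y<x
      ... | inj₂ refl = Pa

  module _ {Q : Pred ℕ 0ℓ} (Q? : Decidable Q) where

    filter-enumerates : ∀ a n → Enumerates (does ∘ Q?) a (filter Q? (range a n)) (a + n)
    filter-enumerates a zero y a≤y y<a+0 = contradiction a≤y (<⇒≱ (subst (y <_) (+-identityʳ a) y<a+0))
    filter-enumerates a (suc n) = cons (subst (Enumerates _ (suc a) _) (sym (+-suc a n)) (filter-enumerates (suc a) n))
      where
      cons : Enumerates (does ∘ Q?) (suc a) (filter Q? (range (suc a) n)) (a + suc n) →
             Enumerates (does ∘ Q?) a (filter Q? (range a (suc n))) (a + suc n)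
      cons E with does (Q? a) in Qa
      ... | true  = ≤-refl , (λ y a≤y y<a → contradiction a≤y (<⇒≱ y<a)) , Qa , E
      ... | false = enumerates-extend (does ∘ Q?) _ E Qa

  cyc≡nth-% : ∀ xs {m} k → length xs ≡ suc m → cyc xs k ≡ nth xs (k % suc m)
  cyc≡nth-% xs k eq with length xs | eq
  ... | _ | refl = refl

  [1+m]%n≡[1+m%n]%n : ∀ m n .{{_ : NonZero n}} → suc m % n ≡ suc (m % n) % n
  [1+m]%n≡[1+m%n]%n m n = trans (cong (λ t → suc t % n) (m≡m%n+[m/n]*n m n)) ([m+kn]%n≡m%n (suc (m % n)) (m / n) n)

  suc-%-cases : ∀ k d .{{_ : NonZero d}} →
                (suc (k % d) < d × suc k % d ≡ suc (k % d)) ⊎ (suc (k % d) ≡ d × suc k % d ≡ 0)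
  suc-%-cases k d with suc (k % d) <? d
  ... | yes 1+r<d = inj₁ (1+r<d , trans ([1+m]%n≡[1+m%n]%n k d) (m<n⇒m%n≡m 1+r<d))
  ... | no  1+r≮d = inj₂ (1+r≡d , trans ([1+m]%n≡[1+m%n]%n k d) (trans (cong (_% d) 1+r≡d) (n%n≡0 d)))
    where
    1+r≡d : suc (k % d) ≡ d
    1+r≡d = ≤-antisym (m%n<n k d) (≮⇒≥ 1+r≮d)

module CoprimeGaps (N′ : ℕ) where

  open import Defs
  open FiniteSums
  open Coprimality
  open Splitting
  open Enumerations
  open import Data.Nat
  open import Data.Nat.Properties
  open import Data.Nat.DivMod
  open import Data.Nat.Divisibility using (∣1⇒≡1; ∣m+n∣m⇒∣n)
  open import Data.Nat.Coprimality using (Coprime; coprime?)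
  open import Algebra.Properties.CommutativeSemigroup +-commutativeSemigroup
    using () renaming (xy∙z≈xz∙y to m+n+o≡m+o+n)
  open import Data.Bool using (Bool; true; false)
  open import Data.Bool.Properties using (∧-conicalˡ)
  import Data.Bool as Bool
  open import Data.List using (List; _∷_; _++_; [_]; length; filter; upTo; applyUpTo)
  open import Data.List.Properties using (map-upTo; filter-++; filter-accept; length-++; length-map; length-applyUpTo)
  open import Data.List.Relation.Unary.All using (All)
  open import Data.Product using (∃-syntax; _×_; _,_; proj₁; proj₂)
  open import Data.Sum using (_⊎_; inj₁; inj₂)
  open import Function using (_∘_)
  open import Relation.Binary.PropositionalEquality hiding ([_])
  open import Relation.Nullary using (Dec; does)
  open ≡-Reasoning

  N : ℕ
  N = suc N′

  P : ℕ → Bool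
  P = coprimeTo N

  coprimeTo? : ∀ u → Dec (Coprime u N)
  coprimeTo? u = coprime? u N

  U : List ℕ
  U = 1 ∷ filter coprimeTo? (range 2 N′)

  φ : ℕ
  φ = length U

  G : List ℕ
  G = gaps N

  U-filter : filter coprimeTo? (range 1 N) ≡ U
  U-filter = filter-accept coprimeTo? (λ (d∣1 , _) → ∣1⇒≡1 d∣1)

  coprimeList-range : coprimeList N ≡ filter coprimeTo? (range 1 (suc N))
  coprimeList-range = cong (filter coprimeTo?) (map-suc-upTo (suc N))

  coprimeList≡ : coprimeList N ≡ U ++ [ suc N ]
  coprimeList≡ = begin
    coprimeList N                                                      ≡⟨ coprimeList-range ⟩
    filter coprimeTo? (range 1 (suc N))                                ≡⟨ cong (filter coprimeTo?) (range-suc 1 N) ⟩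
    filter coprimeTo? (range 1 N ++ [ suc N ])                         ≡⟨ filter-++ coprimeTo? (range 1 N) _ ⟩
    filter coprimeTo? (range 1 N) ++ filter coprimeTo? [ suc N ]       ≡⟨ cong₂ _++_ U-filter (filter-accept coprimeTo? coprime[1+N,N]) ⟩
    U ++ [ suc N ]                                                     ∎
    where
    coprime[1+N,N] : Coprime (suc N) N
    coprime[1+N,N] {d} (d∣1+N , d∣N) = ∣1⇒≡1 (∣m+n∣m⇒∣n (subst (d ∣_) (+-comm 1 N) d∣1+N) d∣N)

  u : ℕ → ℕ
  u k = nth (coprimeList N) k

  length-coprimeList : length (coprimeList N) ≡ suc φ
  length-coprimeList = trans (cong length coprimeList≡) (trans (length-++ U) (+-comm φ 1))

  length-gaps : length G ≡ φ
  length-gaps = trans (length-diffs (coprimeList N)) (cong pred length-coprimeList)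

  u-enumerates : Enumerates P 1 (coprimeList N) (suc (suc N))
  u-enumerates = subst (λ l → Enumerates P 1 l (suc (suc N))) (sym coprimeList-range)
                       (filter-enumerates coprimeTo? 1 (suc N))

  u-coprime : ∀ {k} → k < suc φ → P (u k) ≡ true
  u-coprime k<φ = enumerates-nth P (coprimeList N) u-enumerates (subst (_ <_) (sym length-coprimeList) k<φ)

  u-next : ∀ {k} → k < φ → u k < u (suc k) × (∀ y → u k < y → y < u (suc k) → P y ≡ false)
  u-next k<φ = enumerates-next P (coprimeList N) u-enumerates (subst (_ <_) (sym length-coprimeList) (s<s k<φ))

  u-0 : u 0 ≡ 1
  u-0 = cong (λ l → nth l 0) coprimeList≡

  u-φ : u φ ≡ suc N
  u-φ = trans (cong (λ l → nth l φ) coprimeList≡) (nth-++-length U (suc N))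

  u+gap : ∀ {k} → k < φ → u k + nth G k ≡ u (suc k)
  u+gap {k} k<φ = trans (cong (u k +_) (nth-diffs (coprimeList N) (subst (_ <_) (sym length-coprimeList) (s<s k<φ))))
                        (m+[n∸m]≡n (<⇒≤ (proj₁ (u-next k<φ))))

  -- Reading 𝒢(N) cyclically from position k visits the coprime points of the blocks [eN + 1, (e + 1)N].
  lift : ℕ → ℕ → ℕ
  lift k e = u (k % φ) + e * N

  lift-coprime : ∀ k e → P (lift k e) ≡ true
  lift-coprime k e = trans (coprimeTo-+* N (u (k % φ)) e) (u-coprime (m<n⇒m<1+n (m%n<n k φ)))

  lift-gap : ∀ k e → NextAfter P (lift k e) (cyc G k) × ∃[ e′ ] lift k e + cyc G k ≡ lift (suc k) e′
  lift-gap k e = (0<gap , noneBetween) , next (suc-%-cases k φ)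
    where
    m : ℕ
    m = k % φ
    m<φ : m < φ
    m<φ = m%n<n k φ
    gap≡ : cyc G k ≡ nth G m
    gap≡ = cyc≡nth-% G k length-gaps
    um+gap : u m + cyc G k ≡ u (suc m)
    um+gap = trans (cong (u m +_) gap≡) (u+gap m<φ)
    0<gap : 0 < cyc G k
    0<gap = +-cancelˡ-< (u m) 0 (cyc G k) (subst₂ _<_ (sym (+-identityʳ (u m))) (sym um+gap) (proj₁ (u-next m<φ)))
    shift : ∀ d → lift k e + d ≡ (u m + d) + e * N
    shift d = m+n+o≡m+o+n (u m) (e * N) d
    noneBetween : ∀ d → 0 < d → d < cyc G k → P (lift k e + d) ≡ false
    noneBetween d 0<d d<gap = trans (cong P (shift d)) (trans (coprimeTo-+* N (u m + d) e)
      (proj₂ (u-next m<φ) (u m + d) (subst (_< u m + d) (+-identityʳ (u m)) (+-monoʳ-< (u m) 0<d))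
                                    (subst (u m + d <_) um+gap (+-monoʳ-< (u m) d<gap))))
    lift+gap : lift k e + cyc G k ≡ u (suc m) + e * N
    lift+gap = trans (shift (cyc G k)) (cong (_+ e * N) um+gap)
    next : (suc m < φ × suc k % φ ≡ suc m) ⊎ (suc m ≡ φ × suc k % φ ≡ 0) →
           ∃[ e′ ] lift k e + cyc G k ≡ lift (suc k) e′
    next (inj₁ (_ , 1+k%φ≡)) = e , trans lift+gap (cong (λ i → u i + e * N) (sym 1+k%φ≡))
    next (inj₂ (1+m≡φ , 1+k%φ≡0)) = suc e , (begin
      lift k e + cyc G k          ≡⟨ lift+gap ⟩
      u (suc m) + e * N           ≡⟨ cong (λ i → u i + e * N) 1+m≡φ ⟩
      u φ + e * N                 ≡⟨ cong (_+ e * N) u-φ ⟩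
      suc N + e * N               ≡⟨ cong (_+ (N + e * N)) (sym u-0) ⟩
      u 0 + suc e * N             ≡⟨ cong (λ i → u i + suc e * N) (sym 1+k%φ≡0) ⟩
      lift (suc k) (suc e)        ∎)

  lift-consecutive : ∀ j k e (f : ℕ → ℕ) → (∀ t → f t ≡ cyc G (k + t)) → Consecutive P (lift k e) (applyUpTo f j)
  lift-consecutive zero    k e f f≡ = lift-coprime k e
  lift-consecutive (suc j) k e f f≡ with gap , e′ , next ← lift-gap k e =
    lift-coprime k e ,
    subst (NextAfter P (lift k e)) (sym f0≡) gap ,
    subst (λ y → Consecutive P y (applyUpTo (f ∘ suc) j)) (trans (sym next) (cong (lift k e +_) (sym f0≡)))
          (lift-consecutive j (suc k) e′ (f ∘ suc) (λ t → trans (f≡ (suc t)) (cong (cyc G) (+-suc k t))))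
    where
    f0≡ : f 0 ≡ cyc G k
    f0≡ = trans (f≡ 0) (cong (cyc G) (+-identityʳ k))

  window-consecutive : ∀ {i} j → i < φ → Consecutive P (u i) (window G i j)
  window-consecutive {i} j i<φ =
    subst₂ (Consecutive P) (trans (+-identityʳ _) (cong u (m<n⇒m%n≡m i<φ))) (sym (map-upTo _ j))
           (lift-consecutive j i 0 (λ t → cyc G (i + t)) (λ _ → refl))

  length-window : ∀ i j → length (window G i j) ≡ j
  length-window i j = trans (length-map _ (upTo j)) (length-applyUpTo (λ x → x) j)

  nDrive≡∑drives : ∀ s j → All (0 <_) s → nDrive s j N ≡ ∑ N (λ x → 𝟙 (drives P s j (suc x)))
  nDrive≡∑drives s j pos = begin
    nDrive s j N
      ≡⟨ length-filter-upTo (λ i → canSplit (window G i j) s Bool.≟ true) (length G) ⟩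
    ∑ (length G) (λ i → 𝟙 (does (canSplit (window G i j) s Bool.≟ true)))
      ≡⟨ cong (λ n → ∑ n (λ i → 𝟙 (does (canSplit (window G i j) s Bool.≟ true)))) length-gaps ⟩
    ∑ φ (λ i → 𝟙 (does (canSplit (window G i j) s Bool.≟ true)))
      ≡⟨ ∑-cong-< φ position≡ ⟩
    ∑ φ (𝟙 ∘ D ∘ nth U)
      ≡⟨ cong (λ l → ∑ (length l) (𝟙 ∘ D ∘ nth l)) (sym U-filter) ⟩
    ∑ (length (filter coprimeTo? (range 1 N))) (𝟙 ∘ D ∘ nth (filter coprimeTo? (range 1 N)))
      ≡⟨ ∑-nth-filter-range coprimeTo? (𝟙 ∘ D) 1 N ⟩
    ∑ N (λ x → 𝟙 (P (suc x)) * 𝟙 (D (suc x)))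
      ≡⟨ ∑-cong N (λ x → drives⇒coprime (suc x)) ⟩
    ∑ N (λ x → 𝟙 (D (suc x))) ∎
    where
    D : ℕ → Bool
    D = drives P s j
    𝟙-does : ∀ b → 𝟙 (does (b Bool.≟ true)) ≡ 𝟙 b
    𝟙-does true  = refl
    𝟙-does false = refl
    position≡ : ∀ i → i < φ → 𝟙 (does (canSplit (window G i j) s Bool.≟ true)) ≡ 𝟙 (D (nth U i))
    position≡ i i<φ = trans (𝟙-does _) (cong 𝟙 (begin
      canSplit (window G i j) s                  ≡⟨ canSplit≡drives P (window G i j) s (window-consecutive j i<φ) pos ⟩
      drives P s (length (window G i j)) (u i)   ≡⟨ cong₂ (drives P s) (length-window i j)
                                                          (trans (cong (λ l → nth l i) coprimeList≡) (nth-++ˡ U [ suc N ] i<φ)) ⟩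
      D (nth U i)                                ∎))
    drives⇒coprime : ∀ y → 𝟙 (P y) * 𝟙 (D y) ≡ 𝟙 (D y)
    drives⇒coprime y with D y in Dy
    ... | false = *-zeroʳ (𝟙 (P y))
    ... | true  = cong (λ b → 𝟙 b * 1) (hits-head P s (∧-conicalˡ _ _ Dy))

module PrimeLift {q N : ℕ} (q-prime : Prime q) (q∤N : ¬ q ∣ N) where

  open FiniteSums
  open Coprimality
  open BoolFacts
  open Splitting
  open import Data.Nat
  open import Data.Nat.Properties
  open import Data.Nat.DivMod
  open import Data.Nat.Divisibility
  open import Data.Nat.Primality
  open import Data.Bool using (true)
  open import Data.Product using (_,_)
  open import Data.Sum using ([_,_]′)
  open import Data.Empty using (⊥; ⊥-elim)
  open import Function using (_∘_)
  open import Relation.Binary.PropositionalEquality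
  open import Relation.Nullary using (Dec; yes; no; contradiction)
  open import Relation.Nullary.Decidable using (dec-true; dec-false)
  open import Algebra.Properties.CommutativeSemigroup +-commutativeSemigroup
    using () renaming (xy∙z≈xz∙y to m+n+o≡m+o+n; x∙yz≈xz∙y to m+[n+o]≡m+o+n)
  open ≡-Reasoning

  instance
    q≢0 : NonZero q
    q≢0 = prime⇒nonZero q-prime

  one-in-q-consecutive : ∀ b → ∑ q (λ a → 𝟙 (divisibleBy q (a + b))) ≡ 1
  one-in-q-consecutive zero = only-0 q ≤-refl
    where
    only-0 : ∀ n .{{_ : NonZero n}} → n ≤ q → ∑ n (λ a → 𝟙 (divisibleBy q (a + 0))) ≡ 1
    only-0 (suc n) n<q = cong₂ _+_ (cong 𝟙 (dec-true (q ∣? 0) (q ∣0)))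
      (∑-zero n (λ i i<n → cong 𝟙 (dec-false (q ∣? (suc i + 0))
        (>⇒∤ (subst (_< q) (sym (+-identityʳ (suc i))) (<-≤-trans (s<s i<n) n<q))))))
  one-in-q-consecutive (suc b) = begin
    ∑ q (λ a → 𝟙 (divisibleBy q (a + suc b)))   ≡⟨ ∑-cong q (λ a → cong (𝟙 ∘ divisibleBy q) (+-suc a b)) ⟩
    ∑ q (λ a → 𝟙 (divisibleBy q (suc a + b)))   ≡⟨ ∑-rotate q (λ a → 𝟙 (divisibleBy q (a + b))) wraps ⟩
    ∑ q (λ a → 𝟙 (divisibleBy q (a + b)))       ≡⟨ one-in-q-consecutive b ⟩
    1                                           ∎
    where
    wraps : 𝟙 (divisibleBy q (q + b)) ≡ 𝟙 (divisibleBy q (0 + b))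
    wraps = cong 𝟙 (trans (cong (divisibleBy q) (+-comm q b)) (divisibleBy-+ q b))

  liftMultiples : ℕ → ℕ
  liftMultiples z = ∑ q (λ m → 𝟙 (divisibleBy q (z + m * N)))

  liftMultiples≤1 : ∀ z → liftMultiples z ≤ 1
  liftMultiples≤1 z = ∑-𝟙≤1 q (λ m → divisibleBy q (z + m * N)) unique
    where
    unique : ∀ i k → i < k → k < q → divisibleBy q (z + i * N) ≡ true → divisibleBy q (z + k * N) ≡ true → ⊥
    unique i k i<k k<q q∣i q∣k with t , refl ← m≤n⇒∃[o]m+o≡n (<⇒≤ i<k) =
      [ >⇒∤ {{t≢0}} (≤-<-trans (m≤n+m t i) k<q) , q∤N ]′ (euclidsLemma t N q-prime q∣tN)
      where
      q∣tN : q ∣ t * N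
      q∣tN = ∣m+n∣m⇒∣n (subst (q ∣_) (trans (cong (z +_) (*-distribʳ-+ N i t)) (sym (+-assoc z (i * N) (t * N))))
                                      (does≡true⇒ (q ∣? _) q∣k))
                       (does≡true⇒ (q ∣? _) q∣i)
      t≢0 : NonZero t
      t≢0 = ≢-nonZero (λ t≡0 → <-irrefl (trans (sym (+-identityʳ i)) (cong (i +_) (sym t≡0))) i<k)

  liftMultiples-+q : ∀ z → liftMultiples (z + q) ≡ liftMultiples z
  liftMultiples-+q z = ∑-cong q (λ m → cong 𝟙
    (trans (cong (divisibleBy q) (m+n+o≡m+o+n z q (m * N))) (divisibleBy-+ q (z + m * N))))

  liftMultiples-+*q : ∀ k z → liftMultiples (z + k * q) ≡ liftMultiples z
  liftMultiples-+*q zero    z = cong liftMultiples (+-identityʳ z)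
  liftMultiples-+*q (suc k) z = begin
    liftMultiples (z + (q + k * q)) ≡⟨ cong liftMultiples (m+[n+o]≡m+o+n z q (k * q)) ⟩
    liftMultiples (z + k * q + q)   ≡⟨ liftMultiples-+q (z + k * q) ⟩
    liftMultiples (z + k * q)       ≡⟨ liftMultiples-+*q k z ⟩
    liftMultiples z                 ∎

  ∑-liftMultiples : ∑ q liftMultiples ≡ q
  ∑-liftMultiples = begin
    ∑ q liftMultiples                                     ≡⟨ ∑-comm q q (λ a m → 𝟙 (divisibleBy q (a + m * N))) ⟩
    ∑ q (λ m → ∑ q (λ a → 𝟙 (divisibleBy q (a + m * N)))) ≡⟨ ∑-cong q (λ m → one-in-q-consecutive (m * N)) ⟩
    ∑ q (λ _ → 1)                                         ≡⟨ trans (∑-const q 1) (*-identityʳ q) ⟩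
    q                                                     ∎

  -- z + mN (m < q) meets every residue class mod q: at most one multiple each, q of them over z < q.
  liftMultiples≡1 : ∀ z → liftMultiples z ≡ 1
  liftMultiples≡1 z = begin
    liftMultiples z                     ≡⟨ cong liftMultiples (m≡m%n+[m/n]*n z q) ⟩
    liftMultiples (z % q + (z / q) * q) ≡⟨ liftMultiples-+*q (z / q) (z % q) ⟩
    liftMultiples (z % q)               ≡⟨ ∑≤1≡n⇒≡1 q liftMultiples (λ a _ → liftMultiples≤1 a) ∑-liftMultiples
                                                     (z % q) (m%n<n z q) ⟩
    1                                   ∎

  module Driving (2∣N : 2 ∣ N) (q-odd : ¬ 2 ∣ q) where

    open import Data.Bool using (Bool; false; _∧_; not)
    open import Data.Bool.Properties using (∧-conicalˡ; ∧-conicalʳ; ∧-zeroʳ)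
    open import Data.List using (List; []; _∷_; length)
    open import Data.List.Relation.Unary.All using (All; []; _∷_)
    open import Data.Nat.ListAction using (sum)
    open import Data.Product using (∃-syntax; _×_)

    P Pq D : ℕ → Bool
    P  = coprimeTo N
    Pq = coprimeTo (q * N)
    D  = divisibleBy q

    -- Two such points would differ by exactly q, but both are odd.
    divisible-coprimes-apart : ∀ {a b} → a < b → b < a + 2 * q →
                               P a ≡ true → P b ≡ true → D a ≡ true → D b ≡ true → ⊥
    divisible-coprimes-apart {a} a<b b<a+2q Pa Pb Da Db with t , refl ← m≤n⇒∃[o]m+o≡n (<⇒≤ a<b)
      with ∣m+n∣m⇒∣n (does≡true⇒ (q ∣? (a + t)) Db) (does≡true⇒ (q ∣? a) Da)
    ... | divides zero t≡0 = <-irrefl (trans (sym (+-identityʳ a)) (cong (a +_) (sym t≡0))) a<b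
    ... | divides (suc zero) t≡q+0 = q-odd (odd+t-odd⇒even a q (coprimeTo-even⇒odd 2∣N Pa)
                                        (subst (λ t → ¬ 2 ∣ a + t) (trans t≡q+0 (+-identityʳ q)) (coprimeTo-even⇒odd 2∣N Pb)))
    ... | divides (suc (suc k)) t≡ = <-irrefl refl (<-≤-trans b<a+2q (+-monoʳ-≤ a 2q≤t))
      where
      2q≤t : 2 * q ≤ t
      2q≤t = subst (2 * q ≤_) (sym t≡) (+-monoʳ-≤ q (≤-trans (≤-reflexive (+-identityʳ q)) (m≤m+n q (k * q))))

    patternMultiples : ℕ → List ℕ → ℕ
    patternMultiples z []       = 𝟙 (D z)
    patternMultiples z (s ∷ ss) = 𝟙 (D z) + patternMultiples (z + s) ss

    hits-*prime : ∀ z s → hits Pq z s ≡ hits P z s ∧ (patternMultiples z s ≡ᵇ 0)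
    hits-*prime z [] = trans (coprimeTo-*prime N z q-prime) (cong (P z ∧_) (not≡𝟙≡ᵇ0 (D z)))
      where
      not≡𝟙≡ᵇ0 : ∀ b → not b ≡ (𝟙 b ≡ᵇ 0)
      not≡𝟙≡ᵇ0 true  = refl
      not≡𝟙≡ᵇ0 false = refl
    hits-*prime z (s ∷ ss) rewrite coprimeTo-*prime N z q-prime | hits-*prime (z + s) ss with P z | D z
    ... | true  | true  = sym (∧-zeroʳ _)
    ... | true  | false = refl
    ... | false | _     = refl

    hits-+*N : ∀ z m s → hits P (z + m * N) s ≡ hits P z s
    hits-+*N z m []       = coprimeTo-+* N z m
    hits-+*N z m (s ∷ ss) = cong₂ _∧_ (coprimeTo-+* N z m)
      (trans (cong (λ t → hits P t ss) (m+n+o≡m+o+n z (m * N) s)) (hits-+*N (z + s) m ss))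

    ¬divisible-near : ∀ {z₀ z} → P z₀ ≡ true → D z₀ ≡ true → z₀ < z → z < z₀ + 2 * q →
                      P z ≡ true → 𝟙 (D z) ≡ 0
    ¬divisible-near {z = z} Pz₀ Dz₀ z₀<z z<z₀+2q Pz with D z in Dz
    ... | false = refl
    ... | true  = ⊥-elim (divisible-coprimes-apart z₀<z z<z₀+2q Pz₀ Pz Dz₀ Dz)

    patternMultiples-after : ∀ {z₀} z s → P z₀ ≡ true → D z₀ ≡ true → z₀ < z → z + sum s < z₀ + 2 * q →
                          hits P z s ≡ true → patternMultiples z s ≡ 0
    patternMultiples-after z [] Pz₀ Dz₀ z₀<z end hit = ¬divisible-near Pz₀ Dz₀ z₀<z (≤-<-trans (m≤m+n z 0) end) hit
    patternMultiples-after {z₀} z (s ∷ ss) Pz₀ Dz₀ z₀<z end hit = cong₂ _+_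
      (¬divisible-near Pz₀ Dz₀ z₀<z (≤-<-trans (m≤m+n z _) end) (∧-conicalˡ _ _ hit))
      (patternMultiples-after (z + s) ss Pz₀ Dz₀ (<-≤-trans z₀<z (m≤m+n z s))
        (subst (_< z₀ + 2 * q) (sym (+-assoc z s (sum ss))) end) (∧-conicalʳ _ _ hit))

    patternMultiples≤1 : ∀ z s → All (0 <_) s → hits P z s ≡ true → sum s < 2 * q → patternMultiples z s ≤ 1
    patternMultiples≤1 z [] _ _ _ with D z
    ... | true  = ≤-refl
    ... | false = z≤n
    patternMultiples≤1 z (s ∷ ss) (s>0 ∷ pos) hit s<2q with D z in Dz
    ... | true  = ≤-reflexive (cong suc (patternMultiples-after (z + s) ss (∧-conicalˡ _ _ hit) Dz
                    (m<m+n z s>0) (subst (_< z + 2 * q) (sym (+-assoc z s (sum ss))) (+-monoʳ-< z s<2q)) (∧-conicalʳ _ _ hit)))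
    ... | false = patternMultiples≤1 (z + s) ss pos (∧-conicalʳ _ _ hit) (≤-<-trans (m≤n+m (sum ss) s) s<2q)

    MultipleInPattern : ℕ → List ℕ → Set
    MultipleInPattern z s = ∃[ d ] (d ≤ sum s × P (z + d) ≡ true × D (z + d) ≡ true)

    multipleInPattern-head : ∀ z s → hits P z s ≡ true → D z ≡ true → MultipleInPattern z s
    multipleInPattern-head z s hit Dz = 0 , z≤n , subst (λ t → P t ≡ true) (sym (+-identityʳ z)) (hits-head P s hit) ,
                                             subst (λ t → D t ≡ true) (sym (+-identityʳ z)) Dz

    patternMultiples>0⇒ : ∀ z s → hits P z s ≡ true → 1 ≤ patternMultiples z s → MultipleInPattern z s
    patternMultiples>0⇒ z [] hit h>0 with D z in Dz
    ... | true  = multipleInPattern-head z [] hit Dz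
    patternMultiples>0⇒ z [] hit () | false
    patternMultiples>0⇒ z (s ∷ ss) hit h>0 with D z in Dz
    ... | true  = multipleInPattern-head z (s ∷ ss) hit Dz
    ... | false with d , d≤ , Pd , Dd ← patternMultiples>0⇒ (z + s) ss (∧-conicalʳ _ _ hit) h>0 =
      s + d , +-monoʳ-≤ s d≤ , subst (λ t → P t ≡ true) (+-assoc z s d) Pd ,
                               subst (λ t → D t ≡ true) (+-assoc z s d) Dd

    ∑-patternMultiples : ∀ z s → ∑ q (λ m → patternMultiples (z + m * N) s) ≡ suc (length s)
    ∑-patternMultiples z []       = liftMultiples≡1 z
    ∑-patternMultiples z (s ∷ ss) = begin
      ∑ q (λ m → 𝟙 (D (z + m * N)) + patternMultiples (z + m * N + s) ss)
        ≡⟨ ∑-distrib-+ q (λ m → 𝟙 (D (z + m * N))) (λ m → patternMultiples (z + m * N + s) ss) ⟩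
      liftMultiples z + ∑ q (λ m → patternMultiples (z + m * N + s) ss)
        ≡⟨ cong₂ _+_ (liftMultiples≡1 z) (∑-cong q (λ m → cong (λ t → patternMultiples t ss) (m+n+o≡m+o+n z (m * N) s))) ⟩
      1 + ∑ q (λ m → patternMultiples (z + s + m * N) ss)
        ≡⟨ cong suc (∑-patternMultiples (z + s) ss) ⟩
      suc (suc (length ss)) ∎

    -- For one lift: a window points and b pattern points are multiples of q, c′ window points survive;
    -- liftIndicator is 1 iff the lift is a driving term of length j.
    liftIndicator : ℕ → ℕ → ℕ → ℕ
    liftIndicator j b c′ = 𝟙 ((b ≡ᵇ 0) ∧ (c′ ≡ᵇ suc j))

    liftIndicator-j+1 : ∀ {j a b c′} → a ≤ 1 → (1 ≤ b → 1 ≤ a) → c′ + a ≡ suc j →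
                        liftIndicator j b c′ + a ≡ 1
    liftIndicator-j+1 {a = 0} {0}     {c′} _ _ c′+0≡ = cong (λ t → 𝟙 t + 0)
      (≡⇒≡ᵇ-true (trans (sym (+-identityʳ c′)) c′+0≡))
    liftIndicator-j+1 {a = 0} {suc _}      _ b⇒a _   = contradiction (b⇒a (s≤s z≤n)) (λ ())
    liftIndicator-j+1 {j} {1} {0} {c′}     _ _ c′+1≡ = cong (λ t → 𝟙 t + 1)
      (≢⇒≡ᵇ-false (λ c′≡ → 1+n≢n (sym (trans (sym c′+1≡) (trans (cong (_+ 1) c′≡) (+-comm (suc j) 1))))))
    liftIndicator-j+1 {a = 1} {suc _}      _ _ _     = refl
    liftIndicator-j+1 {a = suc (suc _)} (s≤s ()) _ _

    liftIndicator-j+2 : ∀ {j a b c′} → a ≤ 1 → b ≤ 1 → (1 ≤ b → 1 ≤ a) → c′ + a ≡ suc (suc j) →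
                        liftIndicator j b c′ + b ≡ a
    liftIndicator-j+2 {j} {0} {0} {c′}     _ _ _ c′+0≡ = cong (λ t → 𝟙 t + 0)
      (≢⇒≡ᵇ-false (λ c′≡ → 1+n≢n (trans (sym c′+0≡) (trans (+-identityʳ c′) c′≡))))
    liftIndicator-j+2 {a = 0} {suc _}      _ _ b⇒a _ = contradiction (b⇒a (s≤s z≤n)) (λ ())
    liftIndicator-j+2 {j} {1} {0} {c′}     _ _ _ c′+1≡ = cong (λ t → 𝟙 t + 0)
      (≡⇒≡ᵇ-true (suc-injective (trans (+-comm 1 c′) c′+1≡)))
    liftIndicator-j+2 {a = 1} {1}          _ _ _ _   = refl
    liftIndicator-j+2 {b = suc (suc _)} _ (s≤s ()) _ _
    liftIndicator-j+2 {a = suc (suc _)} (s≤s ()) _ _ _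

    liftIndicator-other : ∀ {j a b c′ c} → a ≤ 1 → c′ + a ≡ c → c ≢ suc j → c ≢ suc (suc j) →
                          liftIndicator j b c′ ≡ 0
    liftIndicator-other {a = 0} {0}     {c′} _ c′+0≡c c≢j+1 _ = cong 𝟙
      (≢⇒≡ᵇ-false (λ c′≡ → c≢j+1 (trans (sym c′+0≡c) (trans (+-identityʳ c′) c′≡))))
    liftIndicator-other {a = 1} {0}     {c′} _ c′+1≡c _ c≢j+2 = cong 𝟙
      (≢⇒≡ᵇ-false (λ c′≡ → c≢j+2 (trans (sym c′+1≡c) (trans (+-comm c′ 1) (cong suc c′≡)))))
    liftIndicator-other {a = 0} {suc _} _ _ _ _ = refl
    liftIndicator-other {a = 1} {suc _} _ _ _ _ = refl
    liftIndicator-other {a = suc (suc _)} (s≤s ()) _ _ _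
    module Residue (s : List ℕ) (pos : All (0 <_) s) (s<2q : sum s < 2 * q) (y : ℕ) where

      g j : ℕ
      g = sum s
      j = length s

      x : ℕ → ℕ
      x m = y + m * N

      removedInWindow removedInPattern liftCount : ℕ → ℕ
      removedInWindow m  = ∑ (suc g) (λ d → 𝟙 (P (y + d) ∧ D (x m + d)))
      removedInPattern m = patternMultiples (x m) s
      liftCount m   = count Pq (x m) g

      x+d : ∀ m d → x m + d ≡ (y + d) + m * N
      x+d m d = m+n+o≡m+o+n y (m * N) d

      P-x+d : ∀ m d → P (x m + d) ≡ P (y + d)
      P-x+d m d = trans (cong P (x+d m d)) (coprimeTo-+* N (y + d) m)

      liftCount+removedInWindow : ∀ m → liftCount m + removedInWindow m ≡ count P y g
      liftCount+removedInWindow m =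
        trans (sym (∑-distrib-+ (suc g) (λ d → 𝟙 (Pq (x m + d))) (λ d → 𝟙 (P (y + d) ∧ D (x m + d)))))
              (∑-cong (suc g) split)
        where
        split : ∀ d → 𝟙 (Pq (x m + d)) + 𝟙 (P (y + d) ∧ D (x m + d)) ≡ 𝟙 (P (y + d))
        split d rewrite coprimeTo-*prime N (x m + d) q-prime | P-x+d m d with P (y + d) | D (x m + d)
        ... | true  | true  = refl
        ... | true  | false = refl
        ... | false | _     = refl

      removedInWindow≤1 : ∀ m → removedInWindow m ≤ 1
      removedInWindow≤1 m = ∑-𝟙≤1 (suc g) (λ d → P (y + d) ∧ D (x m + d)) unique
        where
        unique : ∀ i k → i < k → k < suc g → P (y + i) ∧ D (x m + i) ≡ true → P (y + k) ∧ D (x m + k) ≡ true → ⊥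
        unique i k i<k k≤g hi hk = divisible-coprimes-apart (+-monoʳ-< (x m) i<k)
          (≤-<-trans (+-monoʳ-≤ (x m) (≤-pred k≤g))
                     (subst (x m + g <_) (sym (+-assoc (x m) i (2 * q))) (+-monoʳ-< (x m) (<-≤-trans s<2q (m≤n+m (2 * q) i)))))
          (trans (P-x+d m i) (∧-conicalˡ _ _ hi)) (trans (P-x+d m k) (∧-conicalˡ _ _ hk))
          (∧-conicalʳ _ _ hi) (∧-conicalʳ _ _ hk)

      ∑-removedInWindow : ∑ q removedInWindow ≡ count P y g
      ∑-removedInWindow = trans (∑-comm q (suc g) (λ m d → 𝟙 (P (y + d) ∧ D (x m + d)))) (∑-cong (suc g) column)
        where
        column : ∀ d → ∑ q (λ m → 𝟙 (P (y + d) ∧ D (x m + d))) ≡ 𝟙 (P (y + d))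
        column d = begin
          ∑ q (λ m → 𝟙 (P (y + d) ∧ D (x m + d)))
            ≡⟨ ∑-cong q (λ m → trans (𝟙-∧ (P (y + d)) (D (x m + d)))
                                      (cong (λ t → 𝟙 (P (y + d)) * 𝟙 (D t)) (x+d m d))) ⟩
          ∑ q (λ m → 𝟙 (P (y + d)) * 𝟙 (D (y + d + m * N)))
            ≡⟨ ∑-distribˡ-* q (𝟙 (P (y + d))) _ ⟩
          𝟙 (P (y + d)) * liftMultiples (y + d)
            ≡⟨ cong (𝟙 (P (y + d)) *_) (liftMultiples≡1 (y + d)) ⟩
          𝟙 (P (y + d)) * 1
            ≡⟨ *-identityʳ _ ⟩
          𝟙 (P (y + d)) ∎
          where
          𝟙-∧ : ∀ a b → 𝟙 (a ∧ b) ≡ 𝟙 a * 𝟙 b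
          𝟙-∧ true  b = sym (+-identityʳ (𝟙 b))
          𝟙-∧ false b = refl

      hits-x : ∀ m → hits P (x m) s ≡ hits P y s
      hits-x m = hits-+*N y m s

      removedInPattern≤1 : hits P y s ≡ true → ∀ m → removedInPattern m ≤ 1
      removedInPattern≤1 hit m = patternMultiples≤1 (x m) s pos (trans (hits-x m) hit) s<2q

      removedInPattern⇒removedInWindow : hits P y s ≡ true → ∀ m → 1 ≤ removedInPattern m → 1 ≤ removedInWindow m
      removedInPattern⇒removedInWindow hit m b>0
        with d , d≤g , Pd , Dd ← patternMultiples>0⇒ (x m) s (trans (hits-x m) hit) b>0 =
        ≤-trans (≤-reflexive (cong 𝟙 (sym (∧-intro (trans (sym (P-x+d m d)) Pd) Dd))))
                (term≤∑ (suc g) (λ d → 𝟙 (P (y + d) ∧ D (x m + d))) (s≤s d≤g))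

      drives-x : ∀ {b} → hits P y s ≡ b → ∀ m →
                 drives Pq s j (x m) ≡ (b ∧ (removedInPattern m ≡ᵇ 0)) ∧ (liftCount m ≡ᵇ suc j)
      drives-x refl m = cong (_∧ (liftCount m ≡ᵇ suc j))
        (trans (hits-*prime (x m) s) (cong (_∧ (removedInPattern m ≡ᵇ 0)) (hits-x m)))

      c : ℕ
      c = count P y g

      drivingLift : ℕ → ℕ
      drivingLift m = liftIndicator j (removedInPattern m) (liftCount m)

      ∑drivingLift+j+1≡q : hits P y s ≡ true → c ≡ suc j → ∑ q drivingLift + suc j ≡ q
      ∑drivingLift+j+1≡q hit c≡ = begin
        ∑ q drivingLift + suc j                       ≡⟨ cong (∑ q drivingLift +_) (sym (trans ∑-removedInWindow c≡)) ⟩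
        ∑ q drivingLift + ∑ q removedInWindow         ≡⟨ sym (∑-distrib-+ q drivingLift removedInWindow) ⟩
        ∑ q (λ m → drivingLift m + removedInWindow m) ≡⟨ ∑-cong q pointwise ⟩
        ∑ q (λ _ → 1)                                 ≡⟨ trans (∑-const q 1) (*-identityʳ q) ⟩
        q                                             ∎
        where
        pointwise : ∀ m → drivingLift m + removedInWindow m ≡ 1
        pointwise m = liftIndicator-j+1 {b = removedInPattern m} {liftCount m} (removedInWindow≤1 m)
                        (removedInPattern⇒removedInWindow hit m) (trans (liftCount+removedInWindow m) c≡)

      ∑drivingLift≡1 : hits P y s ≡ true → c ≡ suc (suc j) → ∑ q drivingLift ≡ 1
      ∑drivingLift≡1 hit c≡ = +-cancelʳ-≡ (suc j) _ _ (begin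
        ∑ q drivingLift + suc j                        ≡⟨ cong (∑ q drivingLift +_) (sym (∑-patternMultiples y s)) ⟩
        ∑ q drivingLift + ∑ q removedInPattern         ≡⟨ sym (∑-distrib-+ q drivingLift removedInPattern) ⟩
        ∑ q (λ m → drivingLift m + removedInPattern m) ≡⟨ ∑-cong q pointwise ⟩
        ∑ q removedInWindow                            ≡⟨ trans ∑-removedInWindow c≡ ⟩
        1 + suc j                                      ∎)
        where
        pointwise : ∀ m → drivingLift m + removedInPattern m ≡ removedInWindow m
        pointwise m = liftIndicator-j+2 {b = removedInPattern m} {liftCount m} (removedInWindow≤1 m) (removedInPattern≤1 hit m)
                        (removedInPattern⇒removedInWindow hit m) (trans (liftCount+removedInWindow m) c≡)

      ∑drivingLift≡0 : c ≢ suc j → c ≢ suc (suc j) → ∑ q drivingLift ≡ 0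
      ∑drivingLift≡0 c≢j+1 c≢j+2 = ∑-zero q (λ m _ →
        liftIndicator-other {b = removedInPattern m} {liftCount m} (removedInWindow≤1 m)
                            (liftCount+removedInWindow m) c≢j+1 c≢j+2)

      lifts-driving : ∑ q (λ m → 𝟙 (drives Pq s j (x m)))
                      ≡ 𝟙 (drives P s j y) * (q ∸ suc j) + 𝟙 (drives P s (suc j) y)
      lifts-driving with hits P y s in hit
      ... | false = ∑-zero q (λ m _ → cong 𝟙 (drives-x hit m))
      ... | true  = trans (∑-cong q (λ m → cong 𝟙 (drives-x hit m))) (by-count (c ≟ suc j) (c ≟ suc (suc j)))
        where
        by-count : Dec (c ≡ suc j) → Dec (c ≡ suc (suc j)) →
                   ∑ q drivingLift ≡ 𝟙 (c ≡ᵇ suc j) * (q ∸ suc j) + 𝟙 (c ≡ᵇ suc (suc j))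
        by-count (yes c≡j+1) _ = begin
          ∑ q drivingLift                 ≡⟨ sym (m+n∸n≡m (∑ q drivingLift) (suc j)) ⟩
          ∑ q drivingLift + suc j ∸ suc j ≡⟨ cong (_∸ suc j) (∑drivingLift+j+1≡q hit c≡j+1) ⟩
          q ∸ suc j                       ≡⟨ sym (trans (+-identityʳ _) (*-identityˡ _)) ⟩
          1 * (q ∸ suc j) + 0             ≡⟨ cong₂ (λ u v → 𝟙 u * (q ∸ suc j) + 𝟙 v) (sym (≡⇒≡ᵇ-true c≡j+1))
                                               (sym (≢⇒≡ᵇ-false (λ c≡j+2 → 1+n≢n (trans (sym c≡j+2) c≡j+1)))) ⟩
          𝟙 (c ≡ᵇ suc j) * (q ∸ suc j) + 𝟙 (c ≡ᵇ suc (suc j)) ∎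
        by-count (no c≢j+1) (yes c≡j+2) = trans (∑drivingLift≡1 hit c≡j+2)
          (cong₂ (λ u v → 𝟙 u * (q ∸ suc j) + 𝟙 v) (sym (≢⇒≡ᵇ-false c≢j+1)) (sym (≡⇒≡ᵇ-true c≡j+2)))
        by-count (no c≢j+1) (no c≢j+2) = trans (∑drivingLift≡0 c≢j+1 c≢j+2)
          (cong₂ (λ u v → 𝟙 u * (q ∸ suc j) + 𝟙 v) (sym (≢⇒≡ᵇ-false c≢j+1)) (sym (≢⇒≡ᵇ-false c≢j+2)))

      drives⇒j<q : drives P s j y ≡ true → suc j ≤ q
      drives⇒j<q d = subst (suc j ≤_) (∑drivingLift+j+1≡q (∧-conicalˡ _ _ d) (≡ᵇ-true⇒≡ (∧-conicalʳ _ _ d)))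
                                     (m≤n+m (suc j) (∑ q drivingLift))

    module _ (s : List ℕ) (pos : All (0 <_) s) (s<2q : sum s < 2 * q) where

      private
        j : ℕ
        j = length s
        δ : ℕ → ℕ → ℕ
        δ k y = 𝟙 (drives P s k y)

      ∑-lifts : ∑ (q * N) (λ x → 𝟙 (drives Pq s j (suc x)))
                ≡ ∑ N (λ r → δ j (suc r)) * (q ∸ suc j) + ∑ N (λ r → δ (suc j) (suc r))
      ∑-lifts = begin
        ∑ (q * N) (λ x → 𝟙 (drives Pq s j (suc x)))
          ≡⟨ ∑-* q N _ ⟩
        ∑ q (λ m → ∑ N (λ r → 𝟙 (drives Pq s j (suc (m * N + r)))))
          ≡⟨ ∑-comm q N (λ m r → 𝟙 (drives Pq s j (suc (m * N + r)))) ⟩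
        ∑ N (λ r → ∑ q (λ m → 𝟙 (drives Pq s j (suc (m * N + r)))))
          ≡⟨ ∑-cong N (λ r → ∑-cong q (λ m → cong (λ t → 𝟙 (drives Pq s j (suc t))) (+-comm (m * N) r))) ⟩
        ∑ N (λ r → ∑ q (λ m → 𝟙 (drives Pq s j (suc r + m * N))))
          ≡⟨ ∑-cong N (λ r → Residue.lifts-driving s pos s<2q (suc r)) ⟩
        ∑ N (λ r → δ j (suc r) * (q ∸ suc j) + δ (suc j) (suc r))
          ≡⟨ ∑-distrib-+ N (λ r → δ j (suc r) * (q ∸ suc j)) (λ r → δ (suc j) (suc r)) ⟩
        ∑ N (λ r → δ j (suc r) * (q ∸ suc j)) + ∑ N (λ r → δ (suc j) (suc r))
          ≡⟨ cong (_+ ∑ N (λ r → δ (suc j) (suc r))) ∑-*ʳ ⟩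
        ∑ N (λ r → δ j (suc r)) * (q ∸ suc j) + ∑ N (λ r → δ (suc j) (suc r)) ∎
        where
        ∑-*ʳ : ∑ N (λ r → δ j (suc r) * (q ∸ suc j)) ≡ ∑ N (λ r → δ j (suc r)) * (q ∸ suc j)
        ∑-*ʳ = trans (∑-cong N (λ r → *-comm (δ j (suc r)) (q ∸ suc j)))
                     (trans (∑-distribˡ-* N (q ∸ suc j) (λ r → δ j (suc r))) (*-comm (q ∸ suc j) _))

      driving⇒length<q : 0 < ∑ N (λ r → δ j (suc r)) → suc j ≤ q
      driving⇒length<q ∑>0 with r , _ , δ>0 ← ∑>0⇒term>0 N (λ r → δ j (suc r)) ∑>0 with drives P s j (suc r) in d
      ... | true = Residue.drives⇒j<q s pos s<2q (suc r) d

module Recurrence where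

  open import Defs using (nDrive)
  open FiniteSums
  open Coprimality
  open Splitting
  open import Data.Nat
  open import Data.Nat.Primality using (¬prime[0])
  open import Data.Nat.ListAction using (sum)
  open import Data.List using (length)
  open import Data.List.Relation.Unary.All using (All)
  open import Relation.Binary.PropositionalEquality
  open import Relation.Nullary using (contradiction)
  open ≡-Reasoning

  nDrive-*prime : ∀ {q N} → Prime q → ¬ q ∣ N → 2 ∣ N → ¬ 2 ∣ q → 1 ≤ N →
    ∀ s → All (0 <_) s → sum s < 2 * q →
    nDrive s (length s) (q * N) ≡ nDrive s (length s) N * (q ∸ suc (length s)) + nDrive s (suc (length s)) N
  nDrive-*prime {zero} q-prime = contradiction q-prime ¬prime[0]
  nDrive-*prime {q@(suc q′)} {N@(suc N′)} q-prime q∤N 2∣N q-odd _ s pos s<2q = begin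
    nDrive s j (q * N)
      ≡⟨ CoprimeGaps.nDrive≡∑drives (N′ + q′ * N) s j pos ⟩
    ∑ (q * N) (λ x → 𝟙 (drives (coprimeTo (q * N)) s j (suc x)))
      ≡⟨ PrimeLift.Driving.∑-lifts q-prime q∤N 2∣N q-odd s pos s<2q ⟩
    ∑ N (λ r → 𝟙 (drives (coprimeTo N) s j (suc r))) * (q ∸ suc j)
      + ∑ N (λ r → 𝟙 (drives (coprimeTo N) s (suc j) (suc r)))
      ≡⟨ sym (cong₂ (λ a b → a * (q ∸ suc j) + b) (CoprimeGaps.nDrive≡∑drives N′ s j pos)
                                                  (CoprimeGaps.nDrive≡∑drives N′ s (suc j) pos)) ⟩
    nDrive s j N * (q ∸ suc j) + nDrive s (suc j) N ∎
    where
    j : ℕ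
    j = length s

  nDrive>0⇒length<q : ∀ {q N} → Prime q → ¬ q ∣ N → 2 ∣ N → ¬ 2 ∣ q → 1 ≤ N →
    ∀ s → All (0 <_) s → sum s < 2 * q → 0 < nDrive s (length s) N → suc (length s) ≤ q
  nDrive>0⇒length<q {N = suc N′} q-prime q∤N 2∣N q-odd _ s pos s<2q nDrive>0 =
    PrimeLift.Driving.driving⇒length<q q-prime q∤N 2∣N q-odd s pos s<2q
      (subst (0 <_) (CoprimeGaps.nDrive≡∑drives N′ s (length s) pos) nDrive>0)

open import Defs
open import Data.Nat using (ℕ; _<_)
open import Data.Nat.Primality using (Prime)
open import Data.Integer using (ℤ; +_; _-_; _*_) renaming (_+_ to _+ℤ_)
open import Data.List using (List; length)
open import Data.List.Relation.Unary.All using (All)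
open import Data.Nat.ListAction using (sum)
open import Relation.Binary.PropositionalEquality using (_≡_)

open import Data.Nat using (suc; zero; _≤_; _∸_; s≤s; z≤n)
import Data.Nat as ℕ
import Data.Nat.Properties as ℕ
open import Data.Nat.Primality using (¬prime[0]; ¬prime[1]; prime⇒irreducible)
import Data.Integer.Properties as ℤ
open import Data.Product using (_,_)
open import Data.Sum using (inj₁; inj₂)
open import Relation.Binary.PropositionalEquality using (cong; sym; trans; module ≡-Reasoning)
open import Relation.Nullary using (contradiction)
open Primorials
open Recurrence

+q-+j-+1≡+[q∸1+j] : ∀ q j → suc j ≤ q → + q - + j - + 1 ≡ + (q ∸ suc j)
+q-+j-+1≡+[q∸1+j] q j 1+j≤q = begin
  + q - + j - + 1   ≡⟨ cong (_- + 1) (trans (ℤ.[+m]-[+n]≡m⊖n q j) (ℤ.⊖-≥ j≤q)) ⟩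
  + (q ∸ j) - + 1   ≡⟨ trans (ℤ.[+m]-[+n]≡m⊖n (q ∸ j) 1) (ℤ.⊖-≥ (ℕ.m<n⇒0<n∸m 1+j≤q)) ⟩
  + (q ∸ j ∸ 1)     ≡⟨ cong +_ (trans (ℕ.∸-+-assoc q j 1) (cong (q ∸_) (ℕ.+-comm j 1))) ⟩
  + (q ∸ suc j)     ∎
  where
  open ≡-Reasoning
  j≤q : j ≤ q
  j≤q = ℕ.≤-trans (ℕ.n≤1+n j) 1+j≤q

toℤ-recurrence : ∀ q j a b → (0 < a → suc j ≤ q) →
                 + (a ℕ.* (q ∸ suc j) ℕ.+ b) ≡ (+ q - + j - + 1) * + a +ℤ + b
toℤ-recurrence q j zero    b _       = cong (_+ℤ + b) (sym (ℤ.*-zeroʳ (+ q - + j - + 1)))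
toℤ-recurrence q j (suc a) b a>0⇒j<q = begin
  + (suc a ℕ.* (q ∸ suc j) ℕ.+ b)    ≡⟨ cong (λ t → + (t ℕ.+ b)) (ℕ.*-comm (suc a) (q ∸ suc j)) ⟩
  + ((q ∸ suc j) ℕ.* suc a) +ℤ + b   ≡⟨ cong (_+ℤ + b) (ℤ.pos-* (q ∸ suc j) (suc a)) ⟩
  + (q ∸ suc j) * + suc a +ℤ + b     ≡⟨ cong (λ t → t * + suc a +ℤ + b)
                                             (sym (+q-+j-+1≡+[q∸1+j] q j (a>0⇒j<q (s≤s z≤n)))) ⟩
  (+ q - + j - + 1) * + suc a +ℤ + b ∎
  where open ≡-Reasoning

mainTheorem4 : (p q : ℕ) → Prime p → NextPrime p q →
    (s : List ℕ) → All (λ x → 0 < x) s → sum s < 2 Data.Nat.* q →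
    + nDrive s (length s) (primorial q)
      ≡ (+ q - + length s - + 1) * + nDrive s (length s) (primorial p)
        +ℤ + nDrive s (Data.Nat.suc (length s)) (primorial p)
mainTheorem4 zero          _ p-prime = contradiction p-prime ¬prime[0]
mainTheorem4 (suc zero)    _ p-prime = contradiction p-prime ¬prime[1]
mainTheorem4 p@(suc (suc _)) q _ next@(q-prime , p<q , _) s pos s<2q
  rewrite primorial-nextPrime next =
  trans (cong +_ (nDrive-*prime q-prime q∤p# 2∣p# q-odd (primorial≥1 p) s pos s<2q))
        (toℤ-recurrence q (length s) _ _ (nDrive>0⇒length<q q-prime q∤p# 2∣p# q-odd (primorial≥1 p) s pos s<2q))
  where
  q∤p# : ¬ q ∣ primorial p
  q∤p# = prime∤primorial q-prime p<q
  2∣p# : 2 ∣ primorial p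
  2∣p# = 2∣primorial {p} (s≤s (s≤s z≤n))
  q-odd : ¬ 2 ∣ q
  q-odd 2∣q with prime⇒irreducible q-prime 2∣q
  ... | inj₁ ()
  ... | inj₂ 2≡q = ℕ.<-irrefl 2≡q (ℕ.≤-trans (s≤s (s≤s (s≤s z≤n))) p<q)
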